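{- The formal power series $C_I$ and $C_S$ in the variables $x_1,x_2,\dots$ satisfy $$C_I(x_1,x_2,\dots)=\frac{1+x_1\,C_I(x_1x_2,\,x_2x_3,\,x_3x_4,\dots)}{1-x_1^2\,C_S(x_1^2x_2^2,\,x_2^2x_3^2,\,x_3^2x_4^2,\dots)}.$$
   Context: For a permutation $\pi$ and $k\geq1$, let $\sharp(1\text{ - }2\text{ - }\cdots\text{ - }k)(\pi)$ be the number of increasing subsequences of length $k$ of $\pi$ (index sets $i_1<\dots<i_k$ with $\pi_{i_1}<\dots<\pi_{i_k}$; for $k=1$ this is the length of $\pi$). Let $\mathcal{S}(132)$ be the set of all permutations of all lengths (including the empty one) avoiding the pattern $132$ (no $i<j<k$ with $\pi_i<\pi_k<\pi_j$), and $\mathcal{I}(132)$ the subset of involutions ($\pi=\pi^{ -1}$). Define $C_I(x_1,x_2,\dots)=\sum_{\pi\in\mathcal{I}(132)}\prod_{k\geq1}x_k^{\sharp(1\text{ - }2\text{ - }\cdots\text{ - }k)(\pi)}$ and $C_S(x_1,x_2,\dots)=\sum_{\pi\in\mathcal{S}(132)}\prod_{k\geq1}x_k^{\sharp(1\text{ - }2\text{ - }\cdots\text{ - }k)(\pi)}$. The notation $C(y_1,y_2,\dots)$ denotes substitution $x_k\mapsto y_k$. (It is known that $C_S(x_1,x_2,\dots)=1/(1-x_1C_S(x_1x_2,x_2x_3,\dots))$.) -}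

module Defs where

open import Data.Bool using (Bool; true; false; if_then_else_; _∧_; _∨_; not)
open import Data.Nat using (ℕ; zero; suc; _+_; _*_; _∸_; _<ᵇ_; _≡ᵇ_)
open import Data.List using (List; []; _∷_; map; concat; concatMap; length; _++_; reverse; filterᵇ; upTo; foldr)
open import Data.List.Relation.Binary.Permutation.Propositional using (_↭_)

insertAll : ℕ → List ℕ → List (List ℕ)
insertAll x []       = (x ∷ []) ∷ []
insertAll x (y ∷ ys) = (x ∷ y ∷ ys) ∷ map (y ∷_) (insertAll x ys)

perms : ℕ → List (List ℕ)
perms zero    = [] ∷ []
perms (suc n) = concatMap (insertAll (suc n)) (perms n)

pairAfter : ℕ → List ℕ → Bool
pairAfter a []       = false
pairAfter a (b ∷ cs) =
  foldr (λ c r → ((a <ᵇ c) ∧ (c <ᵇ b)) ∨ r) false cs ∨ pairAfter a cs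

contains132 : List ℕ → Bool
contains132 []       = false
contains132 (a ∷ as) = pairAfter a as ∨ contains132 as

-- 1-indexed entry of π (0 if out of range)
at : List ℕ → ℕ → ℕ
at []       _             = 0
at (x ∷ xs) zero          = 0
at (x ∷ xs) (suc zero)    = x
at (x ∷ xs) (suc (suc i)) = at xs (suc i)

isInvolution : List ℕ → Bool
isInvolution π =
  foldr (λ i r → (at π (at π (suc i)) ≡ᵇ suc i) ∧ r) true (upTo (length π))

-- incAbove b k xs = number of increasing subsequences of xs of length k
-- all of whose entries are > b
incAbove : ℕ → ℕ → List ℕ → ℕ
incAbove b zero    xs       = 1
incAbove b (suc k) []       = 0
incAbove b (suc k) (x ∷ xs) =
  incAbove b (suc k) xs + (if b <ᵇ x then incAbove x k xs else 0)

-- ♯(1-2-…-k)(π) for k ≥ 1 (entries of π are ≥ 1)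
incSeq : ℕ → List ℕ → ℕ
incSeq k π = incAbove 0 k π

-- Monomials in x₁,x₂,… : exponent lists [e₁,e₂,…,e_m], meaning
-- x₁^e₁ ⋯ x_m^e_m (all further exponents 0).  Trailing zeros are
-- irrelevant; `trim` normalises.

Mon : Set
Mon = List ℕ

dropZeros : List ℕ → List ℕ
dropZeros []           = []
dropZeros (zero ∷ xs)  = dropZeros xs
dropZeros (suc k ∷ xs) = suc k ∷ xs

trim : Mon → Mon
trim m = reverse (dropZeros (reverse m))

_⊗_ : Mon → Mon → Mon
[]       ⊗ b        = b
(x ∷ a)  ⊗ []       = x ∷ a
(x ∷ a)  ⊗ (y ∷ b)  = (x + y) ∷ (a ⊗ b)

-- weight of π : ∏_{k≥1} x_k^{♯(1-2-…-k)(π)}  (zero for k > |π|)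
mon : List ℕ → Mon
mon π = map (λ k → incSeq (suc k) π) (upTo (length π))

-- effect on a monomial of x_k ↦ x_k x_{k+1}: exponent of x_j becomes a_j + a_{j-1}
σ₁ : Mon → Mon
σ₁ a = a ⊗ (0 ∷ a)

-- effect of x_k ↦ x_k² x_{k+1}²
σ₂ : Mon → Mon
σ₂ a = map (2 *_) (σ₁ a)

-- Formal power series in x₁,x₂,… with ℕ coefficients, graded by the
-- exponent of x₁: component d is the finite multiset (list) of monomials
-- (with multiplicity) whose x₁-exponent is d.  The series is the formal
-- sum over all d of all monomials in component d.

Series : Set
Series = ℕ → List Mon

-- equality of series = equality of all coefficients
_≈ₛ_ : Series → Series → Set
F ≈ₛ G = ∀ d → map trim (F d) ↭ map trim (G d)

_⊕_ : Series → Series → Series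
(F ⊕ G) d = F d ++ G d

_⊛_ : Series → Series → Series
(F ⊛ G) d =
  concatMap (λ i → concatMap (λ a → map (a ⊗_) (G (d ∸ i))) (F i)) (upTo (suc d))

x₁^ : ℕ → Series
x₁^ k d = if k ≡ᵇ d then (k ∷ []) ∷ [] else []

one : Series
one = x₁^ 0

pow : Series → ℕ → Series
pow A zero    = one
pow A (suc j) = A ⊛ pow A j

-- 1/(1 − A) = Σ_j A^j, for A without terms of x₁-degree 0 (then A^j has
-- no terms of x₁-degree < j, so component d only needs j ≤ d)
geom : Series → Series
geom A d = concatMap (λ j → pow A j d) (upTo (suc d))

-- F(x₁x₂, x₂x₃, …)   (σ₁ preserves the x₁-exponent)
substS₁ : Series → Series
substS₁ F d = map σ₁ (F d)

-- F(x₁²x₂², x₂²x₃², …)   (σ₂ doubles the x₁-exponent)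
substS₂ : Series → Series
substS₂ F d = concatMap (λ j → if (2 * j) ≡ᵇ d then map σ₂ (F j) else []) (upTo (suc d))

-- The generating functions.  The x₁-exponent of mon π is |π|.

S132 : ℕ → List (List ℕ)
S132 n = filterᵇ (λ π → not (contains132 π)) (perms n)

I132 : ℕ → List (List ℕ)
I132 n = filterᵇ isInvolution (S132 n)

C-S : Series
C-S n = map mon (S132 n)

C-I : Series
C-I n = map mon (I132 n)

{-# OPTIONS --safe #-}

-- Every 132-avoiding permutation π of length n + 1 is (α ⊕ 1) ⊖ β with α, β 132-avoiding: the entries
-- before the maximum all exceed those after it, or they would form a 132 with it. The weight
-- ∏ₖ x_k^♯(1-2-⋯-k) is multiplicative over ⊖, and α ↦ α ⊕ 1 turns the weight w(x₁, x₂, …) of α into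
-- x₁ w(x₁x₂, x₂x₃, …).
-- If π is also an involution, then π = π⁻¹ = β⁻¹ ⊖ (α⁻¹ ⊕ 1); so either β is empty and α is an
-- involution, or β = γ ⊖ (α ⊕ 1)⁻¹ for a 132-avoiding involution γ. Iterating, the 132-avoiding
-- involutions are exactly the permutations
--   X₁ ⊖ ⋯ ⊖ X_k ⊖ m ⊖ X_k⁻¹ ⊖ ⋯ ⊖ X₁⁻¹   with X_i = α_i ⊕ 1, α_i ∈ S(132),
-- and m empty or α ⊕ 1 with α ∈ I(132), each in exactly one way. Inversion preserves the weight of a
-- 132-avoider, so each pair X_i, X_i⁻¹ contributes a term of x₁² C_S(x₁²x₂², x₂²x₃², …), the centre m
-- one of 1 + x₁ C_I(x₁x₂, x₂x₃, …), and summing over k gives the geometric series.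
-- Formally, both sides are compared degree by degree in x₁: each is realised by a duplicate-free list
-- of objects whose weights are its monomials, and the involutions and the shapes above are two such
-- lists of the same set, hence permutations of each other.

module Submission where

open import Algebra.Bundles using (CommutativeMonoid)
import Algebra.Solver.CommutativeMonoid as CommutativeMonoidSolver
open import Data.Bool using (Bool; true; false; T; not; _∧_; _∨_; if_then_else_)
import Data.Bool.Properties as Bool
open import Data.Empty using (⊥; ⊥-elim)
open import Data.List
  using (List; []; _∷_; [_]; _++_; _∷ʳ_; initLast; _∷ʳ′_; map; concatMap; length; foldr; reverse;
         upTo; applyUpTo; applyDownFrom)
import Data.List.Properties as List
open import Data.List.Membership.Propositional using (_∈_; _∉_)
import Data.List.Membership.Propositional as Mem
import Data.List.Membership.Propositional.Properties as Mem
import Data.List.Membership.Propositional.Properties.WithK as Mem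
open import Data.List.Relation.Binary.BagAndSetEquality using (∼bag⇒↭)
open import Data.List.Relation.Binary.Permutation.Propositional
  using (_↭_; ↭-refl; ↭-sym; ↭-trans; ↭-prep; ↭-reflexive; ↭⇒↭ₛ; module PermutationReasoning)
import Data.List.Relation.Binary.Permutation.Propositional.Properties as Perm
import Data.List.Relation.Binary.Permutation.Setoid.Properties as PermSetoid
open import Data.List.Relation.Binary.Subset.Propositional using (_⊆_)
open import Data.List.Relation.Unary.All using (All; []; _∷_)
import Data.List.Relation.Unary.All as All
import Data.List.Relation.Unary.All.Properties as Allₚ
open import Data.List.Relation.Unary.Any using (here; there)
open import Data.List.Relation.Unary.Unique.Propositional using (Unique; []; _∷_)
import Data.List.Relation.Unary.Unique.Propositional.Properties as Unique
open import Data.Nat using (ℕ; zero; suc; _+_; _*_; _∸_; _≤_; _<_; z≤n; s≤s; _≟_; _<ᵇ_; _≡ᵇ_)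
import Data.Nat.Induction as ℕ
import Data.Nat.Properties as ℕ
open import Data.Nat.Solver using (module +-*-Solver)
open +-*-Solver using (solve; _:+_; _:*_; _:=_; con)
open import Data.Product using (∃; ∃₂; _×_; _,_; proj₁; proj₂)
import Data.Product as Prod
open import Data.Sum using (_⊎_; inj₁; inj₂)
open import Data.Unit using (⊤; tt)
open import Function.Base using (_∘_; case_of_)
open import Function.Bundles using (Equivalence; _⇔_; mk⇔)
open import Induction.WellFounded using (Acc; acc)
open import Level using (0ℓ)
open import Relation.Binary.Bundles using (Setoid)
open import Relation.Binary.PropositionalEquality
  using (_≡_; _≢_; refl; sym; trans; cong; cong₂; subst; subst₂; setoid; module ≡-Reasoning)
import Relation.Binary.Reasoning.Setoid as ≈-Reasoning
open import Relation.Binary.Structures using (IsEquivalence)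
open import Relation.Nullary using (yes; no)
open import Relation.Nullary.Decidable using (T?)

open import Defs

import Algebra.Properties.CommutativeSemigroup ℕ.+-commutativeSemigroup as +-CS

module _ {A : Set} where

  Unique-resp-↭ : ∀ {xs ys : List A} → xs ↭ ys → Unique xs → Unique ys
  Unique-resp-↭ p = PermSetoid.Unique-resp-↭ (setoid A) (↭⇒↭ₛ p)

  unique⇒↭ : ∀ {xs ys : List A} → Unique xs → Unique ys → xs ⊆ ys → ys ⊆ xs → xs ↭ ys
  unique⇒↭ ux uy xs⊆ys ys⊆xs = ∼bag⇒↭ (Mem.unique∧set⇒bag ux uy (mk⇔ xs⊆ys ys⊆xs))

  ∈-concatMap⁺ : ∀ {B : Set} (f : A → List B) {xs y z} → y ∈ xs → z ∈ f y → z ∈ concatMap f xs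
  ∈-concatMap⁺ f y∈ z∈ = Mem.∈-concatMap⁺ f (Mem.lose y∈ z∈)

  ∈-concatMap⁻ : ∀ {B : Set} (f : A → List B) {xs z} → z ∈ concatMap f xs → ∃ λ y → y ∈ xs × z ∈ f y
  ∈-concatMap⁻ f z∈ = Mem.find (Mem.∈-concatMap⁻ f z∈)

  unique-map⁺ : ∀ {B : Set} (f : A → B) {xs} →
                (∀ {x y} → x ∈ xs → y ∈ xs → f x ≡ f y → x ≡ y) → Unique xs → Unique (map f xs)
  unique-map⁺ f {[]}     inj []         = []
  unique-map⁺ f {x ∷ xs} inj (x∉ ∷ uxs) =
    All.tabulate (λ z∈ fx≡z → let y , y∈ , z≡fy = Mem.∈-map⁻ f z∈ in
                   All.lookup x∉ y∈ (inj (here refl) (there y∈) (trans fx≡z z≡fy)))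
    ∷ unique-map⁺ f (λ p q → inj (there p) (there q)) uxs

  unique-concatMap⁺ : ∀ {B : Set} (f : A → List B) {xs} → Unique xs →
    (∀ {x} → x ∈ xs → Unique (f x)) →
    (∀ {x y z} → x ∈ xs → y ∈ xs → z ∈ f x → z ∈ f y → x ≡ y) →
    Unique (concatMap f xs)
  unique-concatMap⁺ f {[]}     []         uf inj = []
  unique-concatMap⁺ f {x ∷ xs} (x∉ ∷ uxs) uf inj =
    Unique.++⁺ (uf (here refl))
      (unique-concatMap⁺ f uxs (λ p → uf (there p)) (λ p q → inj (there p) (there q)))
      (λ (z∈fx , z∈rest) → let y , y∈ , z∈fy = ∈-concatMap⁻ f z∈rest in
                             All.lookup x∉ y∈ (inj (here refl) (there y∈) z∈fx z∈fy))

  ++-∷-injective : ∀ {x : A} {α β α′ β′} → x ∉ α → x ∉ α′ →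
                   α ++ x ∷ β ≡ α′ ++ x ∷ β′ → α ≡ α′ × β ≡ β′
  ++-∷-injective {α = []}    {α′ = []}     _  _   eq = refl , List.∷-injectiveʳ eq
  ++-∷-injective {α = []}    {α′ = _ ∷ _}  _  x∉′ eq = ⊥-elim (x∉′ (here (List.∷-injectiveˡ eq)))
  ++-∷-injective {α = _ ∷ _} {α′ = []}     x∉ _   eq = ⊥-elim (x∉ (here (sym (List.∷-injectiveˡ eq))))
  ++-∷-injective {α = a ∷ α} {α′ = _ ∷ α′} x∉ x∉′ eq with refl , eq′ ← List.∷-injective eq =
    let α≡ , β≡ = ++-∷-injective (x∉ ∘ there) (x∉′ ∘ there) eq′ in cong (a ∷_) α≡ , β≡

  ++-injective-length : ∀ (xs ys : List A) {xs′ ys′} → length xs ≡ length xs′ →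
                        xs ++ ys ≡ xs′ ++ ys′ → xs ≡ xs′ × ys ≡ ys′
  ++-injective-length []       ys {[]}      _   eq = refl , eq
  ++-injective-length (x ∷ xs) ys {_ ∷ xs′} len eq with refl , eq′ ← List.∷-injective eq =
    let xs≡ , ys≡ = ++-injective-length xs ys (ℕ.suc-injective len) eq′ in cong (x ∷_) xs≡ , ys≡

  unique-++⇒≢ : ∀ {xs ys : List A} {x y} → Unique (xs ++ ys) → x ∈ xs → y ∈ ys → x ≢ y
  unique-++⇒≢ {_ ∷ xs} (x∉ ∷ _) (here refl) y∈ = All.lookup x∉ (Mem.∈-++⁺ʳ xs y∈)
  unique-++⇒≢ {_ ∷ xs} (_ ∷ u)  (there x∈)  y∈ = unique-++⇒≢ u x∈ y∈

  ↭-++-cancelʳ : ∀ {xs ys : List A} zs → xs ++ zs ↭ ys ++ zs → xs ↭ ys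
  ↭-++-cancelʳ {xs} {ys} []       p = subst₂ _↭_ (List.++-identityʳ xs) (List.++-identityʳ ys) p
  ↭-++-cancelʳ {xs} {ys} (z ∷ zs) p = ↭-++-cancelʳ zs (Perm.drop-mid xs ys p)

  concatMap-cong-local : ∀ {B : Set} {f g : A → List B} xs → (∀ {x} → x ∈ xs → f x ≡ g x) →
                         concatMap f xs ≡ concatMap g xs
  concatMap-cong-local []       f≡g = refl
  concatMap-cong-local (x ∷ xs) f≡g = cong₂ _++_ (f≡g (here refl)) (concatMap-cong-local xs (f≡g ∘ there))

  ∈-if⁻ : ∀ {b} {xs : List A} {x} → x ∈ (if b then xs else []) → b ≡ true × x ∈ xs
  ∈-if⁻ {b = true} x∈ = refl , x∈

  if-unique : ∀ b {xs : List A} → Unique xs → Unique (if b then xs else [])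
  if-unique true  u = u
  if-unique false _ = []

  ++-≡-map : ∀ {B : Set} (f : A → B) P Q Z → P ++ Q ≡ map f Z →
             ∃₂ λ Z₁ Z₂ → Z ≡ Z₁ ++ Z₂ × P ≡ map f Z₁ × Q ≡ map f Z₂
  ++-≡-map f []      Q Z       eq = [] , Z , refl , refl , eq
  ++-≡-map f (p ∷ P) Q (z ∷ Z) eq with refl , eq′ ← List.∷-injective eq =
    let Z₁ , Z₂ , Z≡ , P≡ , Q≡ = ++-≡-map f P Q Z eq′ in z ∷ Z₁ , Z₂ , cong (z ∷_) Z≡ , cong (f z ∷_) P≡ , Q≡

  ++-≡-suffix : ∀ P Q {Y W : List A} → P ++ Y ≡ Q ++ W → length W ≤ length Y →
                ∃ λ Y₁ → Y ≡ Y₁ ++ W × P ++ Y₁ ≡ Q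
  ++-≡-suffix []      Q       eq _ = Q , eq , refl
  ++-≡-suffix (p ∷ P) []      {Y} refl |W|≤|Y| =
    ⊥-elim (ℕ.<⇒≱ (s≤s (ℕ.m≤n+m (length Y) (length P))) (subst (_≤ length Y) (List.length-++ (p ∷ P)) |W|≤|Y|))
  ++-≡-suffix (p ∷ P) (q ∷ Q) eq |W|≤|Y| with refl , eq′ ← List.∷-injective eq =
    let Y₁ , Y≡ , P≡ = ++-≡-suffix P Q eq′ |W|≤|Y| in Y₁ , Y≡ , cong (p ∷_) P≡

  applyUpTo-+ : ∀ (f : ℕ → A) m n → applyUpTo f (m + n) ≡ applyUpTo f m ++ applyUpTo (f ∘ (m +_)) n
  applyUpTo-+ f zero    n = refl
  applyUpTo-+ f (suc m) n = cong (f 0 ∷_) (applyUpTo-+ (f ∘ suc) m n)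

  applyUpTo-cong : ∀ {f g : ℕ → A} n → (∀ {i} → i < n → f i ≡ g i) → applyUpTo f n ≡ applyUpTo g n
  applyUpTo-cong zero    f≡g = refl
  applyUpTo-cong (suc n) f≡g = cong₂ _∷_ (f≡g (s≤s z≤n)) (applyUpTo-cong n (f≡g ∘ s≤s))


<ᵇ-true : ∀ {m n} → m < n → (m <ᵇ n) ≡ true
<ᵇ-true m<n = Equivalence.to Bool.T-≡ (ℕ.<⇒<ᵇ m<n)

<ᵇ-false : ∀ {m n} → n ≤ m → (m <ᵇ n) ≡ false
<ᵇ-false {m} {n} n≤m with m <ᵇ n in eq
... | true  = ⊥-elim (ℕ.≤⇒≯ n≤m (ℕ.<ᵇ⇒< m n (Equivalence.from Bool.T-≡ eq)))
... | false = refl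

<ᵇ-+ˡ : ∀ c m n → (c + m <ᵇ c + n) ≡ (m <ᵇ n)
<ᵇ-+ˡ zero    m n = refl
<ᵇ-+ˡ (suc c) m n = <ᵇ-+ˡ c m n

≡ᵇ-true⇒≡ : ∀ {m n} → (m ≡ᵇ n) ≡ true → m ≡ n
≡ᵇ-true⇒≡ {m} {n} eq = ℕ.≡ᵇ⇒≡ m n (Equivalence.from Bool.T-≡ eq)

≡ᵇ-refl : ∀ n → (n ≡ᵇ n) ≡ true
≡ᵇ-refl n = Equivalence.to Bool.T-≡ (ℕ.≡⇒≡ᵇ n n refl)

∨-false : ∀ {x y} → x ∨ y ≡ false → x ≡ false × y ≡ false
∨-false {x} {y} eq = Bool.∨-conicalˡ x y eq , Bool.∨-conicalʳ x y eq

oneTo : ℕ → List ℕ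
oneTo = applyDownFrom suc

IsPerm : List ℕ → Set
IsPerm π = π ↭ oneTo (length π)

∈-oneTo⁻ : ∀ {n v} → v ∈ oneTo n → 1 ≤ v × v ≤ n
∈-oneTo⁻ v∈ with i , i<n , refl ← Mem.∈-applyDownFrom⁻ suc v∈ = s≤s z≤n , i<n

∈-oneTo⁺ : ∀ {n v} → 1 ≤ v → v ≤ n → v ∈ oneTo n
∈-oneTo⁺ {v = suc v} _ v<n = Mem.∈-applyDownFrom⁺ suc v<n

oneTo-unique : ∀ n → Unique (oneTo n)
oneTo-unique n = Unique.applyDownFrom⁺₁ suc n (λ j<i _ → ℕ.<⇒≢ j<i ∘ sym ∘ ℕ.suc-injective)

↭oneTo-length : ∀ {n π} → π ↭ oneTo n → length π ≡ n
↭oneTo-length {n} p = trans (Perm.↭-length p) (List.length-applyDownFrom suc n)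

↭oneTo⇒IsPerm : ∀ {n π} → π ↭ oneTo n → IsPerm π
↭oneTo⇒IsPerm p = subst (λ n → _ ↭ oneTo n) (sym (↭oneTo-length p)) p

module _ {π} (p : IsPerm π) where

  IsPerm-unique : Unique π
  IsPerm-unique = Unique-resp-↭ (↭-sym p) (oneTo-unique _)

  IsPerm-∈ : ∀ {v} → v ∈ π → 1 ≤ v × v ≤ length π
  IsPerm-∈ v∈ = ∈-oneTo⁻ (Perm.∈-resp-↭ p v∈)

  IsPerm-∋ : ∀ {v} → 1 ≤ v → v ≤ length π → v ∈ π
  IsPerm-∋ 1≤v v≤n = Perm.∈-resp-↭ (↭-sym p) (∈-oneTo⁺ 1≤v v≤n)

IsPerm-≥1 : ∀ {π} → IsPerm π → All (1 ≤_) π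
IsPerm-≥1 p = All.tabulate (proj₁ ∘ IsPerm-∈ p)

IsPerm-≤ : ∀ {π} → IsPerm π → All (_≤ length π) π
IsPerm-≤ p = All.tabulate (proj₂ ∘ IsPerm-∈ p)

∈-insertAll⁻ : ∀ {x ys z} → z ∈ insertAll x ys → ∃₂ λ α β → ys ≡ α ++ β × z ≡ α ++ x ∷ β
∈-insertAll⁻ {ys = []}     (here refl) = [] , [] , refl , refl
∈-insertAll⁻ {ys = y ∷ ys} (here refl) = [] , y ∷ ys , refl , refl
∈-insertAll⁻ {ys = y ∷ ys} (there z∈) with w , w∈ , refl ← Mem.∈-map⁻ (y ∷_) z∈ =
  let α , β , ys≡ , w≡ = ∈-insertAll⁻ w∈ in y ∷ α , β , cong (y ∷_) ys≡ , cong (y ∷_) w≡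

∈-insertAll⁺ : ∀ x α β → α ++ x ∷ β ∈ insertAll x (α ++ β)
∈-insertAll⁺ x []      []      = here refl
∈-insertAll⁺ x []      (_ ∷ _) = here refl
∈-insertAll⁺ x (a ∷ α) β       = there (Mem.∈-map⁺ (a ∷_) (∈-insertAll⁺ x α β))

insertAll-unique : ∀ {x ys} → x ∉ ys → Unique (insertAll x ys)
insertAll-unique {ys = []}     _  = [] ∷ []
insertAll-unique {x} {y ∷ ys} x∉ =
  All.tabulate head≢ ∷ unique-map⁺ (y ∷_) (λ _ _ → List.∷-injectiveʳ) (insertAll-unique (x∉ ∘ there))
  where
  head≢ : ∀ {z} → z ∈ map (y ∷_) (insertAll x ys) → x ∷ y ∷ ys ≢ z
  head≢ z∈ eq with _ , _ , refl ← Mem.∈-map⁻ (y ∷_) z∈ = x∉ (here (List.∷-injectiveˡ eq))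

insertAll-disjoint : ∀ {x ys ys′ z} → x ∉ ys → x ∉ ys′ →
                     z ∈ insertAll x ys → z ∈ insertAll x ys′ → ys ≡ ys′
insertAll-disjoint x∉ x∉′ z∈ z∈′
  with α , β , refl , refl ← ∈-insertAll⁻ z∈ | α′ , β′ , refl , eq ← ∈-insertAll⁻ z∈′ =
  let α≡ , β≡ = ++-∷-injective (x∉ ∘ Mem.∈-++⁺ˡ) (x∉′ ∘ Mem.∈-++⁺ˡ) eq in cong₂ _++_ α≡ β≡

∈-perms⁻ : ∀ {n π} → π ∈ perms n → π ↭ oneTo n
∈-perms⁻ {zero}  (here refl) = ↭-refl
∈-perms⁻ {suc n} π∈
  with ys , ys∈ , π∈′ ← ∈-concatMap⁻ (insertAll (suc n)) π∈
  with α , β , refl , refl ← ∈-insertAll⁻ π∈′ =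
  ↭-trans (Perm.shift (suc n) α β) (↭-prep (suc n) (∈-perms⁻ ys∈))

∈-perms⁺ : ∀ {n π} → π ↭ oneTo n → π ∈ perms n
∈-perms⁺ {zero}  p rewrite Perm.↭-empty-inv p = here refl
∈-perms⁺ {suc n} p with α , β , refl ← Mem.∈-∃++ (Perm.∈-resp-↭ (↭-sym p) (here refl)) =
  ∈-concatMap⁺ (insertAll (suc n)) (∈-perms⁺ (Perm.drop-mid α [] p)) (∈-insertAll⁺ (suc n) α β)

perms-unique : ∀ n → Unique (perms n)
perms-unique zero    = [] ∷ []
perms-unique (suc n) =
  unique-concatMap⁺ (insertAll (suc n)) (perms-unique n)
    (λ ys∈ → insertAll-unique (max∉ ys∈)) (λ p q → insertAll-disjoint (max∉ p) (max∉ q))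
  where
  max∉ : ∀ {ys} → ys ∈ perms n → suc n ∉ ys
  max∉ ys∈ n+1∈ = ℕ.1+n≰n (proj₂ (∈-oneTo⁻ (Perm.∈-resp-↭ (∈-perms⁻ ys∈) n+1∈)))

-- Skew sums

infixl 6 _⊖_
_⊖_ : List ℕ → List ℕ → List ℕ
X ⊖ Y = map (length Y +_) X ++ Y

infixl 7 _⊕1
_⊕1 : List ℕ → List ℕ
α ⊕1 = α ∷ʳ suc (length α)

length-⊖ : ∀ X Y → length (X ⊖ Y) ≡ length X + length Y
length-⊖ X Y = trans (List.length-++ (map (length Y +_) X)) (cong (_+ length Y) (List.length-map _ X))

length-⊖ˡ : ∀ X Y → length X ≤ length (X ⊖ Y)
length-⊖ˡ X Y = subst (length X ≤_) (sym (length-⊖ X Y)) (ℕ.m≤m+n (length X) (length Y))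

length-⊕1 : ∀ α → length (α ⊕1) ≡ suc (length α)
length-⊕1 α = trans (List.length-++ α) (ℕ.+-comm (length α) 1)

length-⊕1⊖ : ∀ α Y → length (α ⊕1 ⊖ Y) ≡ length Y + suc (length α)
length-⊕1⊖ α Y = trans (length-⊖ (α ⊕1) Y) (trans (cong (_+ length Y) (length-⊕1 α)) (ℕ.+-comm (suc (length α)) (length Y)))

⊕1-⊖ : ∀ α Y → α ⊕1 ⊖ Y ≡ map (length Y +_) α ++ (length Y + suc (length α)) ∷ Y
⊕1-⊖ α Y = trans (cong (_++ Y) (List.map-++ (length Y +_) α [ suc (length α) ]))
                 (List.++-assoc (map (length Y +_) α) [ length Y + suc (length α) ] Y)

⊖-∷ʳ : ∀ X Y y → X ⊖ (Y ∷ʳ y) ≡ (map (length (Y ∷ʳ y) +_) X ++ Y) ∷ʳ y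
⊖-∷ʳ X Y y = sym (List.++-assoc (map (length (Y ∷ʳ y) +_) X) Y [ y ])

⊖-identityʳ : ∀ X → X ⊖ [] ≡ X
⊖-identityʳ X = trans (List.++-identityʳ _) (List.map-id X)

⊖-assoc : ∀ A B C → (A ⊖ B) ⊖ C ≡ A ⊖ (B ⊖ C)
⊖-assoc A B C = begin
  map (c +_) (map (b +_) A ++ B) ++ C              ≡⟨ cong (_++ C) (List.map-++ (c +_) (map (b +_) A) B) ⟩
  (map (c +_) (map (b +_) A) ++ map (c +_) B) ++ C ≡⟨ List.++-assoc (map (c +_) (map (b +_) A)) (map (c +_) B) C ⟩
  map (c +_) (map (b +_) A) ++ (B ⊖ C)             ≡⟨ cong (_++ (B ⊖ C)) shifts ⟩
  A ⊖ (B ⊖ C)                                       ∎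
  where
  open ≡-Reasoning
  b = length B
  c = length C
  shifts : map (c +_) (map (b +_) A) ≡ map (length (B ⊖ C) +_) A
  shifts = trans (sym (List.map-∘ A)) (List.map-cong (λ x →
    trans (sym (ℕ.+-assoc c b x)) (cong (_+ x) (trans (ℕ.+-comm c b) (sym (length-⊖ B C))))) A)

⊖-cancelˡ : ∀ X {A B} → X ⊖ A ≡ X ⊖ B → A ≡ B
⊖-cancelˡ X {A} {B} eq = proj₂ (++-injective-length (map (length A +_) X) A
  (trans (List.length-map _ X) (sym (List.length-map _ X))) eq)

⊖-cancelʳ : ∀ {A B} Z → A ⊖ Z ≡ B ⊖ Z → A ≡ B
⊖-cancelʳ Z eq = List.map-injective (ℕ.+-cancelˡ-≡ (length Z) _ _) (List.++-cancelʳ Z _ _ eq)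

⊖-interchange : ∀ X Y Z W → X ⊖ Y ≡ Z ⊖ W → length W ≤ length Y → ∃ λ V → Y ≡ V ⊖ W × Z ≡ X ⊖ V
⊖-interchange X Y Z W eq |W|≤|Y|
  with Y₁ , refl , eq′ ← ++-≡-suffix (map (length Y +_) X) (map (length W +_) Z) eq |W|≤|Y|
  with Z₁ , V , refl , X≡ , refl ← ++-≡-map (length W +_) (map (length (Y₁ ++ W) +_) X) Y₁ Z eq′ =
  V , refl , cong (_++ V) Z₁≡
  where
  Z₁≡ : Z₁ ≡ map (length V +_) X
  Z₁≡ = List.map-injective (ℕ.+-cancelˡ-≡ (length W) _ _) (begin
    map (length W +_) Z₁                         ≡⟨ X≡ ⟨
    map (length (V ⊖ W) +_) X                    ≡⟨ List.map-cong shift X ⟩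
    map ((length W +_) ∘ (length V +_)) X        ≡⟨ List.map-∘ X ⟩
    map (length W +_) (map (length V +_) X)      ∎)
    where
    open ≡-Reasoning
    shift : ∀ x → length (V ⊖ W) + x ≡ length W + (length V + x)
    shift x = trans (cong (_+ x) (trans (length-⊖ V W) (ℕ.+-comm (length V) (length W))))
                    (ℕ.+-assoc (length W) (length V) x)

oneTo-+ : ∀ a b → oneTo (a + b) ≡ map (b +_) (oneTo a) ++ oneTo b
oneTo-+ zero    b = refl
oneTo-+ (suc a) b = cong₂ _∷_ (ℕ.+-comm (suc a) b) (oneTo-+ a b)

⊖-isPerm : ∀ {X Y} → IsPerm X → IsPerm Y → IsPerm (X ⊖ Y)
⊖-isPerm {X} {Y} pˣ pʸ = subst (λ n → X ⊖ Y ↭ oneTo n) (sym (length-⊖ X Y))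
  (subst (X ⊖ Y ↭_) (sym (oneTo-+ (length X) (length Y))) (Perm.++⁺ (Perm.map⁺ (length Y +_) pˣ) pʸ))

⊕1-isPerm : ∀ {α} → IsPerm α → IsPerm (α ⊕1)
⊕1-isPerm {α} p = subst (λ n → α ⊕1 ↭ oneTo n) (sym (length-⊕1 α))
  (↭-trans (Perm.++-comm α [ suc (length α) ]) (↭-prep (suc (length α)) p))

unshift : ∀ {c a L} → L ↭ map (c +_) (oneTo a) → ∃ λ α → L ≡ map (c +_) α × α ↭ oneTo a
unshift {c} {a} {L} p = map (_∸ c) L , sym (trans (sym (List.map-∘ L)) (List.map-id-local (All.map ℕ.m+[n∸m]≡n c≤L))) , α↭
  where
  c≤L : All (c ≤_) L
  c≤L = All.tabulate λ x∈ → let y , _ , x≡ = Mem.∈-map⁻ (c +_) (Perm.∈-resp-↭ p x∈) in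
                            subst (c ≤_) (sym x≡) (ℕ.m≤m+n c y)
  α↭ : map (_∸ c) L ↭ oneTo a
  α↭ = subst (map (_∸ c) L ↭_) (trans (sym (List.map-∘ (oneTo a)))
               (trans (List.map-cong (ℕ.m+n∸m≡n c) (oneTo a)) (List.map-id (oneTo a))))
             (Perm.map⁺ (_∸ c) p)

upper-part : ∀ U Y → U ++ Y ↭ oneTo (length U + length Y) → IsPerm Y →
             ∃ λ X → U ≡ map (length Y +_) X × IsPerm X
upper-part U Y p pʸ = let X , U≡ , X↭ = unshift (↭-++-cancelʳ Y U++Y↭) in X , U≡ , ↭oneTo⇒IsPerm X↭
  where
  U++Y↭ : U ++ Y ↭ map (length Y +_) (oneTo (length U)) ++ Y
  U++Y↭ = ↭-trans p (↭-trans (↭-reflexive (oneTo-+ (length U) (length Y)))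
                             (Perm.++⁺ˡ (map (length Y +_) (oneTo (length U))) (↭-sym pʸ)))

⊖-isPermˡ : ∀ {X Y} → IsPerm (X ⊖ Y) → IsPerm Y → IsPerm X
⊖-isPermˡ {X} {Y} p pʸ =
  let X′ , X≡ , X′↭ = upper-part (map (length Y +_) X) Y
                          (subst (λ n → X ⊖ Y ↭ oneTo n) (List.length-++ (map (length Y +_) X)) p) pʸ
  in subst IsPerm (sym (List.map-injective (ℕ.+-cancelˡ-≡ (length Y) _ _) X≡)) X′↭

lower-part-isPerm : ∀ m L R → L ++ R ↭ oneTo m → All (λ x → All (_< x) R) L → IsPerm R
lower-part-isPerm zero    L R p _ rewrite List.++-conicalʳ L R (Perm.↭-empty-inv p) = ↭-refl
lower-part-isPerm (suc m) L R p R<L with Mem.∈-++⁻ L (Perm.∈-resp-↭ (↭-sym p) (here refl))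
lower-part-isPerm (suc m) []      R p R<L          | inj₂ _  = ↭oneTo⇒IsPerm p
lower-part-isPerm (suc m) (x ∷ L) R p (R<x ∷ _)    | inj₂ m∈ =
  ⊥-elim (ℕ.<⇒≱ (All.lookup R<x m∈) (proj₂ (∈-oneTo⁻ (Perm.∈-resp-↭ p (here refl)))))
lower-part-isPerm (suc m) L       R p R<L          | inj₁ m∈ with L₁ , L₂ , refl ← Mem.∈-∃++ m∈ =
  lower-part-isPerm m (L₁ ++ L₂) R p′ (Allₚ.++⁺ R<L₁ (All.tail R<mL₂))
  where
  p′ : (L₁ ++ L₂) ++ R ↭ oneTo m
  p′ = subst (_↭ oneTo m) (sym (List.++-assoc L₁ L₂ R))
         (Perm.drop-mid L₁ [] (subst (_↭ oneTo (suc m)) (List.++-assoc L₁ (suc m ∷ L₂) R) p))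
  R<L₁ = proj₁ (Allₚ.++⁻ L₁ R<L)
  R<mL₂ = proj₂ (Allₚ.++⁻ L₁ R<L)

-- coeff a k is the exponent of x_(k+1) in a.
coeff : Mon → ℕ → ℕ
coeff []      _       = 0
coeff (x ∷ a) zero    = x
coeff (x ∷ a) (suc k) = coeff a k

infix 4 _≈ₘ_
record _≈ₘ_ (a b : Mon) : Set where
  constructor mk≈ₘ
  field coeff-≈ : ∀ k → coeff a k ≡ coeff b k
open _≈ₘ_ public

≈ₘ-isEquivalence : IsEquivalence _≈ₘ_
≈ₘ-isEquivalence = record
  { refl  = mk≈ₘ λ _ → refl
  ; sym   = λ a≈b → mk≈ₘ λ k → sym (coeff-≈ a≈b k)
  ; trans = λ a≈b b≈c → mk≈ₘ λ k → trans (coeff-≈ a≈b k) (coeff-≈ b≈c k)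
  }

≈ₘ-setoid : Setoid 0ℓ 0ℓ
≈ₘ-setoid = record { isEquivalence = ≈ₘ-isEquivalence }

module ≈ₘ-Reasoning = ≈-Reasoning ≈ₘ-setoid

open IsEquivalence ≈ₘ-isEquivalence public
  using () renaming (refl to ≈ₘ-refl; sym to ≈ₘ-sym; trans to ≈ₘ-trans)

coeff-⊗ : ∀ a b k → coeff (a ⊗ b) k ≡ coeff a k + coeff b k
coeff-⊗ []      b       k       = refl
coeff-⊗ (x ∷ a) []      k       = sym (ℕ.+-identityʳ _)
coeff-⊗ (x ∷ a) (y ∷ b) zero    = refl
coeff-⊗ (x ∷ a) (y ∷ b) (suc k) = coeff-⊗ a b k

coeff-σ₁-zero : ∀ a → coeff (σ₁ a) 0 ≡ coeff a 0
coeff-σ₁-zero a = trans (coeff-⊗ a (0 ∷ a) 0) (ℕ.+-identityʳ _)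

coeff-σ₁-suc : ∀ a k → coeff (σ₁ a) (suc k) ≡ coeff a (suc k) + coeff a k
coeff-σ₁-suc a k = coeff-⊗ a (0 ∷ a) (suc k)

coeff-map-2* : ∀ a k → coeff (map (2 *_) a) k ≡ 2 * coeff a k
coeff-map-2* []      k       = refl
coeff-map-2* (x ∷ a) zero    = refl
coeff-map-2* (x ∷ a) (suc k) = coeff-map-2* a k

coeff-applyUpTo : ∀ (f : ℕ → ℕ) n k → coeff (applyUpTo f n) k ≡ (if k <ᵇ n then f k else 0)
coeff-applyUpTo f zero    k       = refl
coeff-applyUpTo f (suc n) zero    = refl
coeff-applyUpTo f (suc n) (suc k) = coeff-applyUpTo (f ∘ suc) n k

⊗-cong : ∀ {a a′ b b′} → a ≈ₘ a′ → b ≈ₘ b′ → a ⊗ b ≈ₘ a′ ⊗ b′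
⊗-cong {a} {a′} {b} {b′} a≈ b≈ = mk≈ₘ λ k → begin
  coeff (a ⊗ b) k          ≡⟨ coeff-⊗ a b k ⟩
  coeff a k + coeff b k    ≡⟨ cong₂ _+_ (coeff-≈ a≈ k) (coeff-≈ b≈ k) ⟩
  coeff a′ k + coeff b′ k  ≡⟨ coeff-⊗ a′ b′ k ⟨
  coeff (a′ ⊗ b′) k        ∎
  where open ≡-Reasoning

σ₁-cong : ∀ {a b} → a ≈ₘ b → σ₁ a ≈ₘ σ₁ b
σ₁-cong {a} {b} a≈b = mk≈ₘ λ where
  zero    → trans (coeff-σ₁-zero a) (trans (coeff-≈ a≈b 0) (sym (coeff-σ₁-zero b)))
  (suc k) → trans (coeff-σ₁-suc a k)
              (trans (cong₂ _+_ (coeff-≈ a≈b (suc k)) (coeff-≈ a≈b k)) (sym (coeff-σ₁-suc b k)))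

infixr 5 _∷ₜ_
_∷ₜ_ : ℕ → Mon → Mon
zero  ∷ₜ []    = []
zero  ∷ₜ y ∷ a = 0 ∷ y ∷ a
suc x ∷ₜ a     = suc x ∷ a

coeff-∷ₜ : ∀ x l k → coeff (x ∷ₜ l) k ≡ coeff (x ∷ l) k
coeff-∷ₜ zero    []      zero    = refl
coeff-∷ₜ zero    []      (suc k) = refl
coeff-∷ₜ zero    (_ ∷ _) k       = refl
coeff-∷ₜ (suc _) _       k       = refl

trim-∷ : ∀ x a → trim (x ∷ a) ≡ x ∷ₜ trim a
trim-∷ x a = begin
  trim (x ∷ a)                                    ≡⟨ cong (reverse ∘ dropZeros) (List.unfold-reverse x a) ⟩
  reverse (dropZeros (reverse a ++ [ x ]))        ≡⟨ cong reverse (dropZeros-++ (reverse a)) ⟩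
  reverse (dropZerosThen (dropZeros (reverse a)))  ≡⟨ reverse-dropZerosThen (dropZeros (reverse a)) ⟩
  x ∷ₜ trim a                                     ∎
  where
  open ≡-Reasoning
  dropZerosThen : List ℕ → List ℕ
  dropZerosThen []       = dropZeros [ x ]
  dropZerosThen (d ∷ ds) = d ∷ ds ++ [ x ]

  dropZeros-++ : ∀ l → dropZeros (l ++ [ x ]) ≡ dropZerosThen (dropZeros l)
  dropZeros-++ []          = refl
  dropZeros-++ (zero ∷ l)  = dropZeros-++ l
  dropZeros-++ (suc d ∷ l) = refl

  ∷ₜ-∷ʳ : ∀ y l d → y ∷ₜ (l ∷ʳ d) ≡ y ∷ l ∷ʳ d
  ∷ₜ-∷ʳ zero    []      d = refl
  ∷ₜ-∷ʳ zero    (_ ∷ _) d = refl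
  ∷ₜ-∷ʳ (suc _) _       d = refl

  ∷ₜ-[] : ∀ y → reverse (dropZeros [ y ]) ≡ y ∷ₜ []
  ∷ₜ-[] zero    = refl
  ∷ₜ-[] (suc _) = refl

  reverse-dropZerosThen : ∀ D → reverse (dropZerosThen D) ≡ x ∷ₜ reverse D
  reverse-dropZerosThen [] = ∷ₜ-[] x
  reverse-dropZerosThen (d ∷ ds) = begin
    reverse ((d ∷ ds) ++ [ x ])  ≡⟨ List.reverse-++ (d ∷ ds) [ x ] ⟩
    x ∷ reverse (d ∷ ds)         ≡⟨ cong (x ∷_) (List.unfold-reverse d ds) ⟩
    x ∷ reverse ds ∷ʳ d          ≡⟨ ∷ₜ-∷ʳ x (reverse ds) d ⟨
    x ∷ₜ (reverse ds ∷ʳ d)       ≡⟨ cong (x ∷ₜ_) (List.unfold-reverse d ds) ⟨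
    x ∷ₜ reverse (d ∷ ds)        ∎

trim-≈ₘ : ∀ a → trim a ≈ₘ a
trim-≈ₘ []      = ≈ₘ-refl
trim-≈ₘ (x ∷ a) = mk≈ₘ λ k → trans (cong (λ l → coeff l k) (trim-∷ x a)) (∷ₜ-coeff k)
  where
  ∷ₜ-coeff : ∀ k → coeff (x ∷ₜ trim a) k ≡ coeff (x ∷ a) k
  ∷ₜ-coeff k = trans (coeff-∷ₜ x (trim a) k) (coeff-∷ k)
    where
    coeff-∷ : ∀ k → coeff (x ∷ trim a) k ≡ coeff (x ∷ a) k
    coeff-∷ zero    = refl
    coeff-∷ (suc k) = coeff-≈ (trim-≈ₘ a) k

trim-≈ₘ[] : ∀ b → [] ≈ₘ b → trim b ≡ []
trim-≈ₘ[] []      _   = refl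
trim-≈ₘ[] (y ∷ b) []≈ =
  trans (trim-∷ y b) (zero-∷ₜ (sym (coeff-≈ []≈ 0)) (trim-≈ₘ[] b (mk≈ₘ λ k → coeff-≈ []≈ (suc k))))
  where
  zero-∷ₜ : ∀ {y l} → y ≡ 0 → l ≡ [] → y ∷ₜ l ≡ []
  zero-∷ₜ refl refl = refl

≈ₘ⇒trim≡ : ∀ {a b} → a ≈ₘ b → trim a ≡ trim b
≈ₘ⇒trim≡ {[]}    {b}     a≈b = sym (trim-≈ₘ[] b a≈b)
≈ₘ⇒trim≡ {x ∷ a} {[]}    a≈b = trim-≈ₘ[] (x ∷ a) (≈ₘ-sym a≈b)
≈ₘ⇒trim≡ {x ∷ a} {y ∷ b} a≈b = begin
  trim (x ∷ a)  ≡⟨ trim-∷ x a ⟩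
  x ∷ₜ trim a   ≡⟨ cong₂ _∷ₜ_ (coeff-≈ a≈b 0) (≈ₘ⇒trim≡ {a} {b} (mk≈ₘ λ k → coeff-≈ a≈b (suc k))) ⟩
  y ∷ₜ trim b   ≡⟨ trim-∷ y b ⟨
  trim (y ∷ b)  ∎
  where open ≡-Reasoning

⊗-assoc : ∀ a b c → (a ⊗ b) ⊗ c ≈ₘ a ⊗ (b ⊗ c)
⊗-assoc a b c = mk≈ₘ λ k → begin
  coeff ((a ⊗ b) ⊗ c) k                ≡⟨ trans (coeff-⊗ (a ⊗ b) c k) (cong (_+ coeff c k) (coeff-⊗ a b k)) ⟩
  coeff a k + coeff b k + coeff c k    ≡⟨ ℕ.+-assoc (coeff a k) (coeff b k) (coeff c k) ⟩
  coeff a k + (coeff b k + coeff c k)  ≡⟨ trans (coeff-⊗ a (b ⊗ c) k) (cong (coeff a k +_) (coeff-⊗ b c k)) ⟨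
  coeff (a ⊗ (b ⊗ c)) k                ∎
  where open ≡-Reasoning

⊗-comm : ∀ a b → a ⊗ b ≈ₘ b ⊗ a
⊗-comm a b = mk≈ₘ λ k →
  trans (coeff-⊗ a b k) (trans (ℕ.+-comm (coeff a k) (coeff b k)) (sym (coeff-⊗ b a k)))

⊗-identityʳ : ∀ a → a ⊗ [] ≈ₘ a
⊗-identityʳ []      = ≈ₘ-refl
⊗-identityʳ (x ∷ a) = ≈ₘ-refl

⊗-commutativeMonoid : CommutativeMonoid 0ℓ 0ℓ
⊗-commutativeMonoid = record
  { Carrier = Mon
  ; _≈_     = _≈ₘ_
  ; _∙_     = _⊗_
  ; ε       = []
  ; isCommutativeMonoid = record
    { isMonoid = record
      { isSemigroup = record
        { isMagma = record { isEquivalence = ≈ₘ-isEquivalence ; ∙-cong = ⊗-cong }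
        ; assoc   = ⊗-assoc
        }
      ; identity = (λ _ → ≈ₘ-refl) , ⊗-identityʳ
      }
    ; comm = ⊗-comm
    }
  }

module ⊗-Solver = CommutativeMonoidSolver ⊗-commutativeMonoid

σ₂-≈ₘ : ∀ a → σ₂ a ≈ₘ σ₁ a ⊗ σ₁ a
σ₂-≈ₘ a = mk≈ₘ λ k → begin
  coeff (map (2 *_) (σ₁ a)) k      ≡⟨ coeff-map-2* (σ₁ a) k ⟩
  2 * coeff (σ₁ a) k               ≡⟨ cong (coeff (σ₁ a) k +_) (ℕ.+-identityʳ _) ⟩
  coeff (σ₁ a) k + coeff (σ₁ a) k  ≡⟨ coeff-⊗ (σ₁ a) (σ₁ a) k ⟨
  coeff (σ₁ a ⊗ σ₁ a) k            ∎
  where open ≡-Reasoning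

incAbove-short : ∀ b k xs → length xs ≤ k → incAbove b (suc k) xs ≡ 0
incAbove-short b k       []       _         = refl
incAbove-short b (suc k) (x ∷ xs) (s≤s len) with b <ᵇ x
... | true  = cong₂ _+_ (incAbove-short b (suc k) xs (ℕ.m≤n⇒m≤1+n len)) (incAbove-short x k xs len)
... | false = cong (_+ 0) (incAbove-short b (suc k) xs (ℕ.m≤n⇒m≤1+n len))

incAbove-lowerBound : ∀ {b b′} k xs → All (b <_) xs → All (b′ <_) xs → incAbove b k xs ≡ incAbove b′ k xs
incAbove-lowerBound zero    xs       _          _            = refl
incAbove-lowerBound (suc k) []       _          _            = refl
incAbove-lowerBound (suc k) (x ∷ xs) (b<x ∷ bs) (b′<x ∷ b′s)
  rewrite <ᵇ-true b<x | <ᵇ-true b′<x = cong (_+ incAbove x k xs) (incAbove-lowerBound (suc k) xs bs b′s)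

incAbove-shift : ∀ c b k xs → incAbove (c + b) k (map (c +_) xs) ≡ incAbove b k xs
incAbove-shift c b zero    xs       = refl
incAbove-shift c b (suc k) []       = refl
incAbove-shift c b (suc k) (x ∷ xs) rewrite <ᵇ-+ˡ c b x with b <ᵇ x
... | true  = cong₂ _+_ (incAbove-shift c b (suc k) xs) (incAbove-shift c x k xs)
... | false = cong (_+ 0) (incAbove-shift c b (suc k) xs)

incAbove-≤ : ∀ b k ys → All (_≤ b) ys → incAbove b (suc k) ys ≡ 0
incAbove-≤ b k []       _            = refl
incAbove-≤ b k (y ∷ ys) (y≤b ∷ ys≤b) rewrite <ᵇ-false {b} {y} y≤b =
  trans (ℕ.+-identityʳ _) (incAbove-≤ b k ys ys≤b)

incAbove-++-below : ∀ b k xs ys → All (λ x → All (_< x) ys) xs → All (_≤ b) ys →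
                    incAbove b k (xs ++ ys) ≡ incAbove b k xs
incAbove-++-below b zero    xs       ys _          _    = refl
incAbove-++-below b (suc k) []       ys _          ys≤b = incAbove-≤ b k ys ys≤b
incAbove-++-below b (suc k) (x ∷ xs) ys (ys<x ∷ h) ys≤b with b <ᵇ x
... | true  = cong₂ _+_ (incAbove-++-below b (suc k) xs ys h ys≤b)
                        (incAbove-++-below x k xs ys h (All.map ℕ.<⇒≤ ys<x))
... | false = cong (_+ 0) (incAbove-++-below b (suc k) xs ys h ys≤b)

incAbove-++ : ∀ b k xs ys → All (λ x → All (_< x) ys) xs →
              incAbove b (suc k) (xs ++ ys) ≡ incAbove b (suc k) xs + incAbove b (suc k) ys
incAbove-++ b k []       ys _          = refl
incAbove-++ b k (x ∷ xs) ys (ys<x ∷ h) with b <ᵇ x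
... | true  = trans (cong₂ _+_ (incAbove-++ b k xs ys h) (incAbove-++-below x k xs ys h (All.map ℕ.<⇒≤ ys<x)))
                    (+-CS.xy∙z≈xz∙y (incAbove b (suc k) xs) (incAbove b (suc k) ys) (incAbove x k xs))
... | false = trans (cong (_+ 0) (incAbove-++ b k xs ys h))
                    (+-CS.xy∙z≈xz∙y (incAbove b (suc k) xs) (incAbove b (suc k) ys) 0)

incAbove-∷ʳ : ∀ b m k xs → b < m → All (_< m) xs →
              incAbove b (suc k) (xs ∷ʳ m) ≡ incAbove b (suc k) xs + incAbove b k xs
incAbove-∷ʳ b m zero    []       b<m _ rewrite <ᵇ-true b<m = refl
incAbove-∷ʳ b m (suc k) []       b<m _ rewrite <ᵇ-true b<m = refl
incAbove-∷ʳ b m zero    (x ∷ xs) b<m (x<m ∷ xs<m) with b <ᵇ x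
... | true  = cong (_+ 1) (incAbove-∷ʳ b m 0 xs b<m xs<m)
... | false = trans (cong (_+ 0) (incAbove-∷ʳ b m 0 xs b<m xs<m)) (+-CS.xy∙z≈xz∙y (incAbove b 1 xs) 1 0)
incAbove-∷ʳ b m (suc k) (x ∷ xs) b<m (x<m ∷ xs<m) with b <ᵇ x
... | true  = trans (cong₂ _+_ (incAbove-∷ʳ b m (suc k) xs b<m xs<m) (incAbove-∷ʳ x m k xs x<m xs<m))
                    (+-CS.interchange (incAbove b (suc (suc k)) xs) (incAbove b (suc k) xs)
                                      (incAbove x (suc k) xs) (incAbove x k xs))
... | false = trans (cong (_+ 0) (incAbove-∷ʳ b m (suc k) xs b<m xs<m))
                    (+-CS.interchange (incAbove b (suc (suc k)) xs) (incAbove b (suc k) xs) 0 0)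

coeff-mon : ∀ π k → coeff (mon π) k ≡ incSeq (suc k) π
coeff-mon π k rewrite List.map-upTo (λ k → incSeq (suc k) π) (length π)
                    | coeff-applyUpTo (λ k → incSeq (suc k) π) (length π) k
                    with k <ᵇ length π in k<n
... | true  = refl
... | false = sym (incAbove-short 0 k π (ℕ.≮⇒≥ (λ k<n′ → subst T k<n (ℕ.<⇒<ᵇ k<n′))))

mon-⊖ : ∀ X Y → All (1 ≤_) X → All (_≤ length Y) Y → mon (X ⊖ Y) ≈ₘ mon X ⊗ mon Y
mon-⊖ X Y X≥1 Y≤n = mk≈ₘ λ k → begin
  coeff (mon (X ⊖ Y)) k                                         ≡⟨ coeff-mon (X ⊖ Y) k ⟩
  incAbove 0 (suc k) (map (n +_) X ++ Y)                         ≡⟨ incAbove-++ 0 k (map (n +_) X) Y Y<X′ ⟩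
  incAbove 0 (suc k) (map (n +_) X) + incSeq (suc k) Y           ≡⟨ cong (_+ incSeq (suc k) Y) (shifted k) ⟩
  incSeq (suc k) X + incSeq (suc k) Y                            ≡⟨ cong₂ _+_ (coeff-mon X k) (coeff-mon Y k) ⟨
  coeff (mon X) k + coeff (mon Y) k                              ≡⟨ coeff-⊗ (mon X) (mon Y) k ⟨
  coeff (mon X ⊗ mon Y) k                                        ∎
  where
  open ≡-Reasoning
  n = length Y
  n<X′ : All (n + 0 <_) (map (n +_) X)
  n<X′ = Allₚ.map⁺ (All.map (ℕ.+-monoʳ-< n) X≥1)
  Y<X′ : All (λ x → All (_< x) Y) (map (n +_) X)
  Y<X′ = All.map (λ {x} n<x → All.map (λ y≤n → ℕ.≤-<-trans (ℕ.≤-trans y≤n (ℕ.m≤m+n n 0)) n<x) Y≤n) n<X′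
  shifted : ∀ k → incAbove 0 (suc k) (map (n +_) X) ≡ incSeq (suc k) X
  shifted k = trans (incAbove-lowerBound (suc k) (map (n +_) X) (All.map (ℕ.<-≤-trans (s≤s z≤n)) n<X′) n<X′)
                  (incAbove-shift n 0 (suc k) X)

mon-⊕1 : ∀ α → All (_≤ length α) α → mon (α ⊕1) ≈ₘ (1 ∷ []) ⊗ σ₁ (mon α)
mon-⊕1 α α≤n = mk≈ₘ coeffs
  where
  open ≡-Reasoning
  α<m : All (_< suc (length α)) α
  α<m = All.map s≤s α≤n

  coeffs : ∀ k → coeff (mon (α ⊕1)) k ≡ coeff ((1 ∷ []) ⊗ σ₁ (mon α)) k
  coeffs zero = begin
    coeff (mon (α ⊕1)) 0
      ≡⟨ trans (coeff-mon (α ⊕1) 0) (incAbove-∷ʳ 0 _ 0 α (s≤s z≤n) α<m) ⟩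
    incSeq 1 α + 1
      ≡⟨ ℕ.+-comm (incSeq 1 α) 1 ⟩
    1 + incSeq 1 α
      ≡⟨ trans (coeff-⊗ (1 ∷ []) (σ₁ (mon α)) 0) (cong suc (trans (coeff-σ₁-zero (mon α)) (coeff-mon α 0))) ⟨
    coeff ((1 ∷ []) ⊗ σ₁ (mon α)) 0 ∎
  coeffs (suc k) = begin
    coeff (mon (α ⊕1)) (suc k)
      ≡⟨ trans (coeff-mon (α ⊕1) (suc k)) (incAbove-∷ʳ 0 _ (suc k) α (s≤s z≤n) α<m) ⟩
    incSeq (2 + k) α + incSeq (suc k) α
      ≡⟨ cong₂ _+_ (coeff-mon α (suc k)) (coeff-mon α k) ⟨
    coeff (mon α) (suc k) + coeff (mon α) k
      ≡⟨ trans (coeff-⊗ (1 ∷ []) (σ₁ (mon α)) (suc k)) (coeff-σ₁-suc (mon α) k) ⟨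
    coeff ((1 ∷ []) ⊗ σ₁ (mon α)) (suc k) ∎

mon-⊖′ : ∀ {X Y} → IsPerm X → IsPerm Y → mon (X ⊖ Y) ≈ₘ mon X ⊗ mon Y
mon-⊖′ {X} {Y} pˣ pʸ = mon-⊖ X Y (IsPerm-≥1 pˣ) (IsPerm-≤ pʸ)

mon-⊕1′ : ∀ {α} → IsPerm α → mon (α ⊕1) ≈ₘ (1 ∷ []) ⊗ σ₁ (mon α)
mon-⊕1′ {α} p = mon-⊕1 α (IsPerm-≤ p)

-- 132-avoidance

Avoids132 : List ℕ → Set
Avoids132 π = contains132 π ≡ false

someBetween : ℕ → ℕ → List ℕ → Bool
someBetween a b cs = foldr (λ c r → ((a <ᵇ c) ∧ (c <ᵇ b)) ∨ r) false cs

someBetween-++ : ∀ a b xs ys → someBetween a b (xs ++ ys) ≡ someBetween a b xs ∨ someBetween a b ys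
someBetween-++ a b []       ys = refl
someBetween-++ a b (x ∷ xs) ys =
  trans (cong (((a <ᵇ x) ∧ (x <ᵇ b)) ∨_) (someBetween-++ a b xs ys))
        (sym (Bool.∨-assoc ((a <ᵇ x) ∧ (x <ᵇ b)) (someBetween a b xs) (someBetween a b ys)))

someBetween-≤ : ∀ a b cs → All (_≤ a) cs → someBetween a b cs ≡ false
someBetween-≤ a b []       _            = refl
someBetween-≤ a b (c ∷ cs) (c≤a ∷ cs≤a) rewrite <ᵇ-false {a} {c} c≤a = someBetween-≤ a b cs cs≤a

someBetween-∈ : ∀ a b cs {c} → someBetween a b cs ≡ false → c ∈ cs → ((a <ᵇ c) ∧ (c <ᵇ b)) ≡ false
someBetween-∈ a b (c ∷ cs) none (here refl) = proj₁ (∨-false none)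
someBetween-∈ a b (x ∷ cs) none (there c∈) = someBetween-∈ a b cs (proj₂ (∨-false {(a <ᵇ x) ∧ (x <ᵇ b)} none)) c∈

someBetween-shift : ∀ c a b cs → someBetween (c + a) (c + b) (map (c +_) cs) ≡ someBetween a b cs
someBetween-shift c a b []       = refl
someBetween-shift c a b (x ∷ cs) rewrite <ᵇ-+ˡ c a x | <ᵇ-+ˡ c x b =
  cong (((a <ᵇ x) ∧ (x <ᵇ b)) ∨_) (someBetween-shift c a b cs)

pairAfter-++ˡ : ∀ a xs ys → pairAfter a (xs ++ ys) ≡ false → pairAfter a xs ≡ false
pairAfter-++ˡ a []       ys _    = refl
pairAfter-++ˡ a (b ∷ xs) ys none with between , after ← ∨-false {someBetween a b (xs ++ ys)} none =
  cong₂ _∨_ (proj₁ (∨-false (trans (sym (someBetween-++ a b xs ys)) between))) (pairAfter-++ˡ a xs ys after)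

pairAfter-++-≤ : ∀ a xs ys → pairAfter a xs ≡ false → All (_≤ a) ys → pairAfter a (xs ++ ys) ≡ false
pairAfter-++-≤ a []       []       _    _            = refl
pairAfter-++-≤ a []       (b ∷ ys) _    (_ ∷ ys≤a)   =
  cong₂ _∨_ (someBetween-≤ a b ys ys≤a) (pairAfter-++-≤ a [] ys refl ys≤a)
pairAfter-++-≤ a (b ∷ xs) ys       none ys≤a with between , after ← ∨-false {someBetween a b xs} none =
  cong₂ _∨_ (trans (someBetween-++ a b xs ys) (cong₂ _∨_ between (someBetween-≤ a b ys ys≤a)))
            (pairAfter-++-≤ a xs ys after ys≤a)

pairAfter-∷ʳ : ∀ a m xs → pairAfter a xs ≡ false → All (_< m) xs → pairAfter a (xs ∷ʳ m) ≡ false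
pairAfter-∷ʳ a m []       _    _            = refl
pairAfter-∷ʳ a m (b ∷ xs) none (b<m ∷ xs<m) with between , after ← ∨-false {someBetween a b xs} none =
  cong₂ _∨_ (trans (someBetween-++ a b xs [ m ]) (cong₂ _∨_ between m-not-between))
            (pairAfter-∷ʳ a m xs after xs<m)
  where
  m-not-between : someBetween a b [ m ] ≡ false
  m-not-between rewrite <ᵇ-false {m} {b} (ℕ.<⇒≤ b<m) | Bool.∧-zeroʳ (a <ᵇ m) = refl

pairAfter-shift : ∀ c a cs → pairAfter (c + a) (map (c +_) cs) ≡ pairAfter a cs
pairAfter-shift c a []       = refl
pairAfter-shift c a (b ∷ cs) = cong₂ _∨_ (someBetween-shift c a b cs) (pairAfter-shift c a cs)

pairAfter-mid : ∀ a L b R → pairAfter a (L ++ b ∷ R) ≡ false → someBetween a b R ≡ false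
pairAfter-mid a []      b R none = proj₁ (∨-false {someBetween a b R} none)
pairAfter-mid a (y ∷ L) b R none = pairAfter-mid a L b R (proj₂ (∨-false {someBetween a y (L ++ b ∷ R)} none))

avoids-++ˡ : ∀ xs ys → Avoids132 (xs ++ ys) → Avoids132 xs
avoids-++ˡ []       ys _     = refl
avoids-++ˡ (a ∷ xs) ys avoid with first , later ← ∨-false {pairAfter a (xs ++ ys)} avoid =
  cong₂ _∨_ (pairAfter-++ˡ a xs ys first) (avoids-++ˡ xs ys later)

avoids-++ʳ : ∀ xs ys → Avoids132 (xs ++ ys) → Avoids132 ys
avoids-++ʳ []       ys avoid = avoid
avoids-++ʳ (a ∷ xs) ys avoid = avoids-++ʳ xs ys (proj₂ (∨-false {pairAfter a (xs ++ ys)} avoid))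

avoids-++ : ∀ xs ys → Avoids132 xs → Avoids132 ys → All (λ x → All (_≤ x) ys) xs → Avoids132 (xs ++ ys)
avoids-++ []       ys _     avoid _              = avoid
avoids-++ (a ∷ xs) ys avoid avoidʸ (ys≤a ∷ ys≤xs) with first , later ← ∨-false {pairAfter a xs} avoid =
  cong₂ _∨_ (pairAfter-++-≤ a xs ys first ys≤a) (avoids-++ xs ys later avoidʸ ys≤xs)

avoids-∷ʳ : ∀ m xs → Avoids132 xs → All (_< m) xs → Avoids132 (xs ∷ʳ m)
avoids-∷ʳ m []       _     _            = refl
avoids-∷ʳ m (a ∷ xs) avoid (a<m ∷ xs<m) with first , later ← ∨-false {pairAfter a xs} avoid =
  cong₂ _∨_ (pairAfter-∷ʳ a m xs first xs<m) (avoids-∷ʳ m xs later xs<m)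

contains132-shift : ∀ c xs → contains132 (map (c +_) xs) ≡ contains132 xs
contains132-shift c []       = refl
contains132-shift c (a ∷ xs) = cong₂ _∨_ (pairAfter-shift c a xs) (contains132-shift c xs)

avoids-mid : ∀ L b R {x c} → Avoids132 (L ++ b ∷ R) → x ∈ L → c ∈ R → ((x <ᵇ c) ∧ (c <ᵇ b)) ≡ false
avoids-mid (x ∷ L) b R avoid (here refl) c∈ =
  someBetween-∈ x b R (pairAfter-mid x L b R (proj₁ (∨-false {pairAfter x (L ++ b ∷ R)} avoid))) c∈
avoids-mid (y ∷ L) b R avoid (there x∈) c∈ =
  avoids-mid L b R (proj₂ (∨-false {pairAfter y (L ++ b ∷ R)} avoid)) x∈ c∈

⊖-avoids : ∀ X Y → Avoids132 X → Avoids132 Y → All (_≤ length Y) Y → Avoids132 (X ⊖ Y)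
⊖-avoids X Y avoidˣ avoidʸ Y≤n =
  avoids-++ (map (length Y +_) X) Y (trans (contains132-shift (length Y) X) avoidˣ) avoidʸ
    (Allₚ.map⁺ (All.tabulate (λ {x} _ → All.map (λ y≤n → ℕ.≤-trans y≤n (ℕ.m≤m+n (length Y) x)) Y≤n)))

⊖-avoidsˡ : ∀ X Y → Avoids132 (X ⊖ Y) → Avoids132 X
⊖-avoidsˡ X Y avoid = trans (sym (contains132-shift (length Y) X)) (avoids-++ˡ (map (length Y +_) X) Y avoid)

⊕1-avoids : ∀ α → Avoids132 α → All (_≤ length α) α → Avoids132 (α ⊕1)
⊕1-avoids α avoid α≤n = avoids-∷ʳ (suc (length α)) α avoid (All.map s≤s α≤n)

record Avoider (π : List ℕ) : Set where
  constructor mkAvoider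
  field
    isPerm : IsPerm π
    avoids : Avoids132 π
open Avoider public

⊖-avoider : ∀ {X Y} → Avoider X → Avoider Y → Avoider (X ⊖ Y)
⊖-avoider {X} {Y} (mkAvoider pˣ aˣ) (mkAvoider pʸ aʸ) = mkAvoider (⊖-isPerm pˣ pʸ) (⊖-avoids X Y aˣ aʸ (IsPerm-≤ pʸ))

⊕1-avoider : ∀ {α} → Avoider α → Avoider (α ⊕1)
⊕1-avoider {α} (mkAvoider p a) = mkAvoider (⊕1-isPerm p) (⊕1-avoids α a (IsPerm-≤ p))

⊖-avoiderˡ : ∀ {X Y} → Avoider (X ⊖ Y) → Avoider Y → Avoider X
⊖-avoiderˡ {X} {Y} (mkAvoider p a) (mkAvoider pʸ _) = mkAvoider (⊖-isPermˡ p pʸ) (⊖-avoidsˡ X Y a)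

record Decomposition (π : List ℕ) : Set where
  constructor decomposition
  field
    {α β}    : List ℕ
    avoiderα : Avoider α
    avoiderβ : Avoider β
    π≡       : π ≡ α ⊕1 ⊖ β

-- An entry c of R below some y of L would form the pattern 132 with m.
below-max-split : ∀ L m R → Unique (L ++ m ∷ R) → All (_≤ m) R → Avoids132 (L ++ m ∷ R) →
                  All (λ x → All (_< x) R) L
below-max-split L m R unique R≤m avoid = All.tabulate λ {y} y∈ → All.tabulate λ {c} c∈ →
  let not-y<c : (y <ᵇ c) ≡ false
      not-y<c = trans (sym (Bool.∧-identityʳ (y <ᵇ c)))
                      (subst (λ t → (y <ᵇ c) ∧ t ≡ false) (<ᵇ-true (R<m c∈)) (avoids-mid L m R avoid y∈ c∈))
  in ℕ.≤∧≢⇒< (ℕ.≮⇒≥ (λ y<c → subst T not-y<c (ℕ.<⇒<ᵇ y<c)))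
             (λ c≡y → unique-++⇒≢ unique y∈ (there c∈) (sym c≡y))
  where
  R<m : ∀ {c} → c ∈ R → c < m
  R<m c∈ = ℕ.≤∧≢⇒< (All.lookup R≤m c∈)
    (λ c≡m → unique-++⇒≢ {xs = L ∷ʳ m} (subst Unique (sym (List.++-assoc L [ m ] R)) unique)
                          (Mem.∈-++⁺ʳ L (here refl)) c∈ (sym c≡m))

decompose : ∀ {π n} → π ↭ oneTo (suc n) → Avoids132 π → Decomposition π
decompose {π} {n} p avoid
  with L , R , refl ← Mem.∈-∃++ (Perm.∈-resp-↭ (↭-sym p) (here refl)) =
  decomposition (mkAvoider α↭ (avoids-++ˡ α _ (⊖-avoidsˡ (α ⊕1) R (subst Avoids132 π≡ avoid))))
                (mkAvoider R↭ (avoids-++ʳ (L ∷ʳ suc n) R (subst Avoids132 (sym (List.++-assoc L [ suc n ] R)) avoid)))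
                π≡
  where
  R<L : All (λ x → All (_< x) R) L
  R<L = below-max-split L (suc n) R (IsPerm-unique (↭oneTo⇒IsPerm p))
          (All.tabulate λ c∈ → proj₂ (∈-oneTo⁻ (Perm.∈-resp-↭ p (Mem.∈-++⁺ʳ L (there c∈))))) avoid
  LR↭ : L ++ R ↭ oneTo n
  LR↭ = Perm.drop-mid L [] p
  R↭ : IsPerm R
  R↭ = lower-part-isPerm n L R LR↭ R<L
  |L|+|R|≡n : length L + length R ≡ n
  |L|+|R|≡n = trans (sym (List.length-++ L)) (↭oneTo-length LR↭)
  upper : ∃ λ α → L ≡ map (length R +_) α × IsPerm α
  upper = upper-part L R (subst (λ m → L ++ R ↭ oneTo m) (sym |L|+|R|≡n) LR↭) R↭
  α = proj₁ upper
  L≡ = proj₁ (proj₂ upper)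
  α↭ = proj₂ (proj₂ upper)
  n+1≡ : suc n ≡ length R + suc (length α)
  n+1≡ = begin
    suc n                       ≡⟨ cong suc |L|+|R|≡n ⟨
    suc (length L + length R)   ≡⟨ ℕ.+-comm (suc (length L)) (length R) ⟩
    length R + suc (length L)   ≡⟨ cong (λ L → length R + suc (length L)) L≡ ⟩
    length R + suc (length (map (length R +_) α)) ≡⟨ cong (λ m → length R + suc m) (List.length-map _ α) ⟩
    length R + suc (length α)   ∎
    where open ≡-Reasoning
  π≡ : L ++ suc n ∷ R ≡ α ⊕1 ⊖ R
  π≡ = trans (cong₂ (λ L m → L ++ m ∷ R) L≡ n+1≡) (sym (⊕1-⊖ α R))

decomposition-shorter : ∀ {π} α β → π ≡ α ⊕1 ⊖ β → length α < length π × length β < length π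
decomposition-shorter {π} α β refl =
  subst (length α <_) (sym |π|) (s≤s (ℕ.m≤m+n (length α) (length β))) ,
  subst (length β <_) (sym |π|) (s≤s (ℕ.m≤n+m (length β) (length α)))
  where
  |π| : length (α ⊕1 ⊖ β) ≡ suc (length α + length β)
  |π| = trans (length-⊖ (α ⊕1) β) (cong (_+ length β) (length-⊕1 α))

-- Inverses

pos : ℕ → List ℕ → ℕ
pos v []       = 0
pos v (x ∷ xs) with v ≟ x
... | yes _ = 1
... | no  _ = suc (pos v xs)

infixl 8 _⁻¹
_⁻¹ : List ℕ → List ℕ
π ⁻¹ = applyUpTo (λ i → pos (suc i) π) (length π)

length-⁻¹ : ∀ π → length (π ⁻¹) ≡ length π
length-⁻¹ π = List.length-applyUpTo _ (length π)

pos-++-∉ : ∀ v xs ys → v ∉ xs → pos v (xs ++ ys) ≡ length xs + pos v ys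
pos-++-∉ v []       ys _  = refl
pos-++-∉ v (x ∷ xs) ys v∉ with v ≟ x
... | yes v≡x = ⊥-elim (v∉ (here v≡x))
... | no  _   = cong suc (pos-++-∉ v xs ys (v∉ ∘ there))

pos-++-∈ : ∀ v xs ys → v ∈ xs → pos v (xs ++ ys) ≡ pos v xs
pos-++-∈ v (x ∷ xs) ys v∈ with v ≟ x | v∈
... | yes _   | _         = refl
... | no  v≢x | here v≡x  = ⊥-elim (v≢x v≡x)
... | no  _   | there v∈′ = cong suc (pos-++-∈ v xs ys v∈′)

pos-shift : ∀ c v xs → pos (c + v) (map (c +_) xs) ≡ pos v xs
pos-shift c v []       = refl
pos-shift c v (x ∷ xs) with c + v ≟ c + x | v ≟ x
... | yes _     | yes _   = refl
... | yes c+v≡  | no  v≢x = ⊥-elim (v≢x (ℕ.+-cancelˡ-≡ c v x c+v≡))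
... | no  c+v≢  | yes v≡x = ⊥-elim (c+v≢ (cong (c +_) v≡x))
... | no  _     | no  _   = cong suc (pos-shift c v xs)

⁻¹-⊖ : ∀ {X} Y → IsPerm X → (X ⊖ Y) ⁻¹ ≡ Y ⁻¹ ⊖ X ⁻¹
⁻¹-⊖ {X} Y pˣ = begin
  (X ⊖ Y) ⁻¹                                   ≡⟨ cong (applyUpTo f) |X⊖Y|≡ ⟩
  applyUpTo f (n + a)                          ≡⟨ applyUpTo-+ f n a ⟩
  applyUpTo f n ++ applyUpTo (f ∘ (n +_)) a    ≡⟨ cong₂ _++_ (applyUpTo-cong n lower) (applyUpTo-cong a upper) ⟩
  applyUpTo ((a +_) ∘ posʸ) n ++ X ⁻¹           ≡⟨ cong (_++ X ⁻¹) (sym (List.map-applyUpTo posʸ (a +_) n)) ⟩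
  map (a +_) (Y ⁻¹) ++ X ⁻¹                     ≡⟨ cong (λ m → map (m +_) (Y ⁻¹) ++ X ⁻¹) (length-⁻¹ X) ⟨
  Y ⁻¹ ⊖ X ⁻¹                                   ∎
  where
  open ≡-Reasoning
  n = length Y
  a = length X
  f = λ i → pos (suc i) (X ⊖ Y)
  posʸ = λ i → pos (suc i) Y
  |X⊖Y|≡ : length (X ⊖ Y) ≡ n + a
  |X⊖Y|≡ = trans (length-⊖ X Y) (ℕ.+-comm a n)
  lower : ∀ {i} → i < n → f i ≡ a + posʸ i
  lower {i} i<n = trans (pos-++-∉ (suc i) (map (n +_) X) Y ∉X′) (cong (_+ posʸ i) (List.length-map _ X))
    where
    ∉X′ : suc i ∉ map (n +_) X
    ∉X′ i∈ = let x , x∈ , i≡ = Mem.∈-map⁻ (n +_) i∈ in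
             ℕ.<⇒≱ (subst (n <_) (sym i≡) (ℕ.m<m+n n (proj₁ (IsPerm-∈ pˣ x∈)))) i<n
  upper : ∀ {i} → i < a → f (n + i) ≡ pos (suc i) X
  upper {i} i<a = begin
    pos (suc (n + i)) (X ⊖ Y)               ≡⟨ cong (λ v → pos v (X ⊖ Y)) (sym (ℕ.+-suc n i)) ⟩
    pos (n + suc i) (map (n +_) X ++ Y)     ≡⟨ pos-++-∈ (n + suc i) (map (n +_) X) Y
                                                   (Mem.∈-map⁺ (n +_) (IsPerm-∋ pˣ (s≤s z≤n) i<a)) ⟩
    pos (n + suc i) (map (n +_) X)          ≡⟨ pos-shift n (suc i) X ⟩
    pos (suc i) X                           ∎

⁻¹-⊕1 : ∀ {α} → IsPerm α → (α ⊕1) ⁻¹ ≡ α ⁻¹ ⊕1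
⁻¹-⊕1 {α} p = begin
  (α ⊕1) ⁻¹                               ≡⟨ cong (applyUpTo f) (length-⊕1 α) ⟩
  applyUpTo f (suc a)                     ≡⟨ List.applyUpTo-∷ʳ f a ⟨
  applyUpTo f a ∷ʳ f a                    ≡⟨ cong₂ _∷ʳ_ (applyUpTo-cong a below) top ⟩
  α ⁻¹ ∷ʳ suc a                           ≡⟨ cong (λ m → α ⁻¹ ∷ʳ suc m) (length-⁻¹ α) ⟨
  α ⁻¹ ⊕1                                 ∎
  where
  open ≡-Reasoning
  a = length α
  f = λ i → pos (suc i) (α ⊕1)
  below : ∀ {i} → i < a → f i ≡ pos (suc i) α
  below i<a = pos-++-∈ _ α _ (IsPerm-∋ p (s≤s z≤n) i<a)
  top : f a ≡ suc a
  top = begin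
    pos (suc a) (α ++ [ suc a ])   ≡⟨ pos-++-∉ (suc a) α [ suc a ] (λ a+1∈ → ℕ.1+n≰n (proj₂ (IsPerm-∈ p a+1∈))) ⟩
    a + pos (suc a) [ suc a ]      ≡⟨ cong (a +_) (pos-here (suc a)) ⟩
    a + 1                          ≡⟨ ℕ.+-comm a 1 ⟩
    suc a                          ∎
    where
    pos-here : ∀ v → pos v [ v ] ≡ 1
    pos-here v with v ≟ v
    ... | yes _   = refl
    ... | no  v≢v = ⊥-elim (v≢v refl)

⁻¹-⊕1⊖ : ∀ {α} β → IsPerm α → (α ⊕1 ⊖ β) ⁻¹ ≡ β ⁻¹ ⊖ α ⁻¹ ⊕1
⁻¹-⊕1⊖ {α} β p = trans (⁻¹-⊖ β (⊕1-isPerm p)) (cong (β ⁻¹ ⊖_) (⁻¹-⊕1 p))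

-- The three facts are proved together by induction along `decompose`.
record AvoiderInverse (π : List ℕ) : Set where
  field
    avoider⁻¹     : Avoider (π ⁻¹)
    mon-⁻¹        : mon (π ⁻¹) ≈ₘ mon π
    ⁻¹-involutive : π ⁻¹ ⁻¹ ≡ π
open AvoiderInverse

avoiderInverse-⊕1⊖ : ∀ {α β} → Avoider α → Avoider β → AvoiderInverse α → AvoiderInverse β →
                     AvoiderInverse (α ⊕1 ⊖ β)
avoiderInverse-⊕1⊖ {α} {β} aα aβ invα invβ = record
  { avoider⁻¹     = subst Avoider (sym ⁻¹≡) (⊖-avoider (avoider⁻¹ invβ) (⊕1-avoider (avoider⁻¹ invα)))
  ; mon-⁻¹        = subst (λ π → mon π ≈ₘ mon (α ⊕1 ⊖ β)) (sym ⁻¹≡) mon≈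
  ; ⁻¹-involutive = involutive
  }
  where
  ⁻¹≡ = ⁻¹-⊕1⊖ β (isPerm aα)
  pα⁻¹ = isPerm (avoider⁻¹ invα)

  involutive : (α ⊕1 ⊖ β) ⁻¹ ⁻¹ ≡ α ⊕1 ⊖ β
  involutive = begin
    (α ⊕1 ⊖ β) ⁻¹ ⁻¹         ≡⟨ cong _⁻¹ ⁻¹≡ ⟩
    (β ⁻¹ ⊖ α ⁻¹ ⊕1) ⁻¹      ≡⟨ ⁻¹-⊖ (α ⁻¹ ⊕1) (isPerm (avoider⁻¹ invβ)) ⟩
    (α ⁻¹ ⊕1) ⁻¹ ⊖ β ⁻¹ ⁻¹   ≡⟨ cong (_⊖ β ⁻¹ ⁻¹) (⁻¹-⊕1 pα⁻¹) ⟩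
    α ⁻¹ ⁻¹ ⊕1 ⊖ β ⁻¹ ⁻¹     ≡⟨ cong₂ (λ α β → α ⊕1 ⊖ β) (⁻¹-involutive invα) (⁻¹-involutive invβ) ⟩
    α ⊕1 ⊖ β                 ∎
    where open ≡-Reasoning

  mon≈ : mon (β ⁻¹ ⊖ α ⁻¹ ⊕1) ≈ₘ mon (α ⊕1 ⊖ β)
  mon≈ = begin
    mon (β ⁻¹ ⊖ α ⁻¹ ⊕1)                 ≈⟨ mon-⊖′ (isPerm (avoider⁻¹ invβ)) (⊕1-isPerm pα⁻¹) ⟩
    mon (β ⁻¹) ⊗ mon (α ⁻¹ ⊕1)           ≈⟨ ⊗-cong (mon-⁻¹ invβ) (mon-⊕1′ pα⁻¹) ⟩
    mon β ⊗ ((1 ∷ []) ⊗ σ₁ (mon (α ⁻¹))) ≈⟨ ⊗-cong (≈ₘ-refl {mon β})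
                                               (⊗-cong (≈ₘ-refl {1 ∷ []}) (σ₁-cong (mon-⁻¹ invα))) ⟩
    mon β ⊗ ((1 ∷ []) ⊗ σ₁ (mon α))      ≈⟨ ⊗-cong (≈ₘ-refl {mon β}) (mon-⊕1′ (isPerm aα)) ⟨
    mon β ⊗ mon (α ⊕1)                   ≈⟨ ⊗-comm (mon β) (mon (α ⊕1)) ⟩
    mon (α ⊕1) ⊗ mon β                   ≈⟨ mon-⊖′ (⊕1-isPerm (isPerm aα)) (isPerm aβ) ⟨
    mon (α ⊕1 ⊖ β)                       ∎
    where open ≈ₘ-Reasoning

avoiderInverse : ∀ {π} → Avoider π → AvoiderInverse π
avoiderInverse a = go (ℕ.<-wellFounded _) a
  where
  go : ∀ {π} → Acc _<_ (length π) → Avoider π → AvoiderInverse π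
  go {[]}     _        _ = record { avoider⁻¹ = mkAvoider ↭-refl refl ; mon-⁻¹ = ≈ₘ-refl ; ⁻¹-involutive = refl }
  go {x ∷ xs} (acc rs) a with decomposition {α} {β} aα aβ π≡ ← decompose (isPerm a) (avoids a) =
    let α< , β< = decomposition-shorter α β π≡ in
    subst AvoiderInverse (sym π≡) (avoiderInverse-⊕1⊖ aα aβ (go (rs α<) aα) (go (rs β<) aβ))

at-applyUpTo : ∀ (f : ℕ → ℕ) n {i} → i < n → at (applyUpTo f n) (suc i) ≡ f i
at-applyUpTo f (suc n) {zero}  _         = refl
at-applyUpTo f (suc n) {suc i} (s≤s i<n) = at-applyUpTo (f ∘ suc) n i<n

at-∈ : ∀ xs {i} → i < length xs → at xs (suc i) ∈ xs
at-∈ (x ∷ xs) {zero}  _         = here refl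
at-∈ (x ∷ xs) {suc i} (s≤s i<n) = there (at-∈ xs i<n)

at-ext : ∀ xs ys → length xs ≡ length ys → (∀ {i} → i < length xs → at xs (suc i) ≡ at ys (suc i)) → xs ≡ ys
at-ext []       []       _   _    = refl
at-ext (x ∷ xs) (y ∷ ys) len at≡ =
  cong₂ _∷_ (at≡ (s≤s z≤n)) (at-ext xs ys (ℕ.suc-injective len) (at≡ ∘ s≤s))

pos-at : ∀ xs {i} → Unique xs → i < length xs → pos (at xs (suc i)) xs ≡ suc i
pos-at (x ∷ xs) {zero}  _          _ with x ≟ x
... | yes _   = refl
... | no  x≢x = ⊥-elim (x≢x refl)
pos-at (x ∷ xs) {suc i} (x∉ ∷ u) (s≤s i<n) with at xs (suc i) ≟ x
... | yes at≡x = ⊥-elim (All.lookup x∉ (at-∈ xs i<n) (sym at≡x))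
... | no  _    = cong suc (pos-at xs u i<n)

at-pos : ∀ xs {v} → v ∈ xs → ∃ λ j → pos v xs ≡ suc j × j < length xs × at xs (suc j) ≡ v
at-pos (x ∷ xs) {v} v∈ with v ≟ x | v∈
... | yes v≡x | _         = 0 , refl , s≤s z≤n , sym v≡x
... | no  v≢x | here v≡x  = ⊥-elim (v≢x v≡x)
... | no  _   | there v∈′ = let j , pos≡ , j<n , at≡ = at-pos xs v∈′ in suc j , cong suc pos≡ , s≤s j<n , at≡

at-⁻¹ : ∀ π {i} → i < length π → at (π ⁻¹) (suc i) ≡ pos (suc i) π
at-⁻¹ π = at-applyUpTo (λ i → pos (suc i) π) (length π)

foldr-∧-true⁻ : ∀ (g : ℕ → Bool) (f : ℕ → ℕ) n → foldr (λ i r → g i ∧ r) true (applyUpTo f n) ≡ true →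
                ∀ {i} → i < n → g (f i) ≡ true
foldr-∧-true⁻ g f (suc n) all {i} i<n with g (f 0) in g0 | i | i<n
... | true | zero  | _         = g0
... | true | suc i | s≤s i<n′  = foldr-∧-true⁻ g (f ∘ suc) n all i<n′

foldr-∧-true⁺ : ∀ (g : ℕ → Bool) (f : ℕ → ℕ) n → (∀ {i} → i < n → g (f i) ≡ true) →
                foldr (λ i r → g i ∧ r) true (applyUpTo f n) ≡ true
foldr-∧-true⁺ g f zero    _   = refl
foldr-∧-true⁺ g f (suc n) all rewrite all {0} (s≤s z≤n) = foldr-∧-true⁺ g (f ∘ suc) n (all ∘ s≤s)

isInvolution⇔ : ∀ {π} → IsPerm π → (isInvolution π ≡ true) ⇔ (π ⁻¹ ≡ π)
isInvolution⇔ {π} p = mk⇔ to from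
  where
  n = length π
  from : π ⁻¹ ≡ π → isInvolution π ≡ true
  from inv≡ = foldr-∧-true⁺ (λ i → at π (at π (suc i)) ≡ᵇ suc i) (λ i → i) n λ {i} i<n →
    let j , pos≡ , _ , at≡ = at-pos π (IsPerm-∋ p (s≤s z≤n) i<n)
        π[i]≡ : at π (suc i) ≡ suc j
        π[i]≡ = trans (cong (λ σ → at σ (suc i)) (sym inv≡)) (trans (at-⁻¹ π i<n) pos≡)
    in Equivalence.to Bool.T-≡ (ℕ.≡⇒≡ᵇ _ _ (trans (cong (at π) π[i]≡) at≡))
  to : isInvolution π ≡ true → π ⁻¹ ≡ π
  to invol = at-ext (π ⁻¹) π (length-⁻¹ π) λ {i} i<n′ →
    let i<n = subst (i <_) (length-⁻¹ π) i<n′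
        ππ≡ : at π (at π (suc i)) ≡ suc i
        ππ≡ = ℕ.≡ᵇ⇒≡ _ _ (Equivalence.from Bool.T-≡ (foldr-∧-true⁻ _ (λ i → i) n invol i<n))
    in trans (at-⁻¹ π i<n) (pos-π[i] (at π (suc i)) ππ≡ (at-∈ π i<n))
    where
    pos-π[i] : ∀ {i} w → at π w ≡ suc i → w ∈ π → pos (suc i) π ≡ w
    pos-π[i] zero    _   w∈ = ⊥-elim (ℕ.1+n≰n (proj₁ (IsPerm-∈ p w∈)))
    pos-π[i] (suc j) ππ≡ w∈ =
      trans (cong (λ v → pos v π) (sym ππ≡)) (pos-at π (IsPerm-unique p) (proj₂ (IsPerm-∈ p w∈)))

record InvolutiveAvoider (π : List ℕ) : Set where
  constructor mkInvolutiveAvoider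
  field
    avoider    : Avoider π
    involutive : π ⁻¹ ≡ π
open InvolutiveAvoider

-- Comparing last entries of π = (α ⊕1) ⊖ β and π⁻¹ = β⁻¹ ⊖ (α⁻¹ ⊕1) shows that (α ⊕1)⁻¹ is
-- no longer than β, so it splits off β as a suffix; γ is the rest of β.
involution-tail : ∀ {α β} → Avoider α → Avoider β → β ≢ [] → (α ⊕1 ⊖ β) ⁻¹ ≡ α ⊕1 ⊖ β →
                  ∃ λ γ → InvolutiveAvoider γ × β ≡ γ ⊖ (α ⊕1) ⁻¹
involution-tail {α} {β} aα aβ β≢[] invol with initLast β
... | []        = ⊥-elim (β≢[] refl)
... | β′ ∷ʳ′ l  = γ , mkInvolutiveAvoider aγ γ-involutive , β≡
  where
  open ≡-Reasoning
  X = α ⊕1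
  invX = avoiderInverse (⊕1-avoider aα)
  E : X ⊖ β ≡ β ⁻¹ ⊖ X ⁻¹
  E = trans (sym invol) (⁻¹-⊖ β (⊕1-isPerm (isPerm aα)))
  l≡ : l ≡ suc (length (α ⁻¹))
  l≡ = List.∷ʳ-injectiveʳ _ _ (begin
    (map (length β +_) X ++ β′) ∷ʳ l                 ≡⟨ ⊖-∷ʳ X β′ l ⟨
    X ⊖ β                                             ≡⟨ E ⟩
    β ⁻¹ ⊖ X ⁻¹                                       ≡⟨ cong (β ⁻¹ ⊖_) (⁻¹-⊕1 (isPerm aα)) ⟩
    β ⁻¹ ⊖ α ⁻¹ ⊕1                                    ≡⟨ ⊖-∷ʳ (β ⁻¹) (α ⁻¹) _ ⟩
    (map (length (α ⁻¹ ⊕1) +_) (β ⁻¹) ++ α ⁻¹) ∷ʳ suc (length (α ⁻¹)) ∎)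
  |X⁻¹|≤|β| : length (X ⁻¹) ≤ length β
  |X⁻¹|≤|β| = subst (_≤ length β) (trans l≡ (sym (trans (cong length (⁻¹-⊕1 (isPerm aα))) (length-⊕1 (α ⁻¹)))))
                    (proj₂ (IsPerm-∈ (isPerm aβ) (Mem.∈-++⁺ʳ β′ (here refl))))
  split = ⊖-interchange X β (β ⁻¹) (X ⁻¹) E |X⁻¹|≤|β|
  γ = proj₁ split
  β≡ : β ≡ γ ⊖ X ⁻¹
  β≡ = proj₁ (proj₂ split)
  aγ : Avoider γ
  aγ = ⊖-avoiderˡ (subst Avoider β≡ aβ) (avoider⁻¹ invX)
  γ-involutive : γ ⁻¹ ≡ γ
  γ-involutive = sym (⊖-cancelˡ X (begin
    X ⊖ γ              ≡⟨ proj₂ (proj₂ split) ⟨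
    β ⁻¹               ≡⟨ cong _⁻¹ β≡ ⟩
    (γ ⊖ X ⁻¹) ⁻¹      ≡⟨ ⁻¹-⊖ (X ⁻¹) (isPerm aγ) ⟩
    X ⁻¹ ⁻¹ ⊖ γ ⁻¹     ≡⟨ cong (_⊖ γ ⁻¹) (⁻¹-involutive invX) ⟩
    X ⊖ γ ⁻¹           ∎))

-- The shape of a 132-avoiding involution

Centre : List ℕ → Set
Centre m = m ≡ [] ⊎ ∃ λ α → InvolutiveAvoider α × m ≡ α ⊕1

wrap : List ℕ → List (List ℕ) → List ℕ
wrap m []      = m
wrap m (α ∷ g) = α ⊕1 ⊖ (wrap m g ⊖ (α ⊕1) ⁻¹)

chainSize : List (List ℕ) → ℕ
chainSize []      = 0
chainSize (α ∷ g) = (2 + 2 * length α) + chainSize g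

centre-involutive : ∀ {m} → Centre m → InvolutiveAvoider m
centre-involutive (inj₁ refl)                                   = mkInvolutiveAvoider (mkAvoider ↭-refl refl) refl
centre-involutive (inj₂ (α , mkInvolutiveAvoider aα invα , refl)) =
  mkInvolutiveAvoider (⊕1-avoider aα) (trans (⁻¹-⊕1 (isPerm aα)) (cong _⊕1 invα))

wrap-involutive : ∀ {m} g → Centre m → All Avoider g → InvolutiveAvoider (wrap m g)
wrap-involutive []      cm []         = centre-involutive cm
wrap-involutive {m} (α ∷ g) cm (aα ∷ ag) =
  mkInvolutiveAvoider (⊖-avoider aX (⊖-avoider (avoider iW) (avoider⁻¹ invX))) (begin
    (X ⊖ (W ⊖ X ⁻¹)) ⁻¹      ≡⟨ ⁻¹-⊖ (W ⊖ X ⁻¹) (isPerm aX) ⟩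
    (W ⊖ X ⁻¹) ⁻¹ ⊖ X ⁻¹     ≡⟨ cong (_⊖ X ⁻¹) (⁻¹-⊖ (X ⁻¹) (isPerm (avoider iW))) ⟩
    X ⁻¹ ⁻¹ ⊖ W ⁻¹ ⊖ X ⁻¹    ≡⟨ cong₂ (λ A B → A ⊖ B ⊖ X ⁻¹) (⁻¹-involutive invX) (involutive iW) ⟩
    X ⊖ W ⊖ X ⁻¹             ≡⟨ ⊖-assoc X W (X ⁻¹) ⟩
    X ⊖ (W ⊖ X ⁻¹)           ∎)
  where
  open ≡-Reasoning
  X = α ⊕1
  W = wrap m g
  aX = ⊕1-avoider aα
  invX = avoiderInverse aX
  iW = wrap-involutive g cm ag

length-wrap : ∀ {m} g → length (wrap m g) ≡ length m + chainSize g
length-wrap {m} []      = sym (ℕ.+-identityʳ (length m))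
length-wrap {m} (α ∷ g) = begin
  length (α ⊕1 ⊖ (W ⊖ (α ⊕1) ⁻¹))
    ≡⟨ trans (length-⊖ (α ⊕1) _) (cong (length (α ⊕1) +_) (length-⊖ W _)) ⟩
  length (α ⊕1) + (length W + length ((α ⊕1) ⁻¹))
    ≡⟨ cong (λ l → length (α ⊕1) + (length W + l)) (length-⁻¹ (α ⊕1)) ⟩
  length (α ⊕1) + (length W + length (α ⊕1))
    ≡⟨ cong₂ (λ a w → a + (w + a)) (length-⊕1 α) (length-wrap g) ⟩
  suc a + ((length m + chainSize g) + suc a)
    ≡⟨ arithmetic a (length m) (chainSize g) ⟩
  length m + ((2 + 2 * a) + chainSize g) ∎
  where
  open ≡-Reasoning
  W = wrap m g
  a = length α
  arithmetic : ∀ a m c → suc a + ((m + c) + suc a) ≡ m + ((2 + 2 * a) + c)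
  arithmetic = solve 3 (λ a m c → (con 1 :+ a) :+ ((m :+ c) :+ (con 1 :+ a)) := m :+ ((con 2 :+ con 2 :* a) :+ c)) refl

-- The maximal entry of α ⊕1 ⊖ Y marks where α ends and Y begins.
⊕1⊖-injective : ∀ {α α′ Y Y′} → IsPerm α → IsPerm α′ → α ⊕1 ⊖ Y ≡ α′ ⊕1 ⊖ Y′ → α ≡ α′ × Y ≡ Y′
⊕1⊖-injective {α} {α′} {Y} {Y′} pα pα′ eq =
  List.map-injective (ℕ.+-cancelˡ-≡ (length Y) _ _) (trans α₁≡ (cong (λ Z → map (length Z +_) α′) (sym Y≡))) , Y≡
  where
  N = length (α ⊕1 ⊖ Y)
  N≡ : length Y + suc (length α) ≡ N
  N≡ = sym (length-⊕1⊖ α Y)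
  N≡′ : length Y′ + suc (length α′) ≡ N
  N≡′ = sym (trans (cong length eq) (length-⊕1⊖ α′ Y′))
  N∉ : ∀ {β Z} → IsPerm β → length Z + suc (length β) ≡ N → N ∉ map (length Z +_) β
  N∉ {β} {Z} pβ N≡ N∈ = let x , x∈ , N≡x = Mem.∈-map⁻ (length Z +_) N∈ in
    ℕ.<-irrefl (sym N≡x) (subst (length Z + x <_) N≡ (ℕ.+-monoʳ-< (length Z) (s≤s (proj₂ (IsPerm-∈ pβ x∈)))))
  split : map (length Y +_) α ++ N ∷ Y ≡ map (length Y′ +_) α′ ++ N ∷ Y′
  split = begin
    map (length Y +_) α ++ N ∷ Y                          ≡⟨ cong (λ n → map (length Y +_) α ++ n ∷ Y) N≡ ⟨
    map (length Y +_) α ++ (length Y + suc (length α)) ∷ Y ≡⟨ ⊕1-⊖ α Y ⟨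
    α ⊕1 ⊖ Y                                               ≡⟨ eq ⟩
    α′ ⊕1 ⊖ Y′                                             ≡⟨ ⊕1-⊖ α′ Y′ ⟩
    map (length Y′ +_) α′ ++ (length Y′ + suc (length α′)) ∷ Y′ ≡⟨ cong (λ n → map (length Y′ +_) α′ ++ n ∷ Y′) N≡′ ⟩
    map (length Y′ +_) α′ ++ N ∷ Y′                       ∎
    where open ≡-Reasoning
  halves = ++-∷-injective (N∉ {Z = Y} pα N≡) (N∉ {Z = Y′} pα′ N≡′) split
  α₁≡ = proj₁ halves
  Y≡ = proj₂ halves

-- The last entry of X ⊖ Y lies in Y, below the maximum; the last entry of β ⊕1 is the maximum.
⊖≢⊕1 : ∀ X {Y} β → IsPerm Y → 0 < length X → Y ≢ [] → X ⊖ Y ≢ β ⊕1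
⊖≢⊕1 X {Y} β pʸ 0<|X| Y≢[] eq with initLast Y
... | []       = Y≢[] refl
... | Y′ ∷ʳ′ y = ℕ.<-irrefl y≡ (ℕ.≤-<-trans y≤ |Y|<)
  where
  y≡ : y ≡ suc (length β)
  y≡ = List.∷ʳ-injectiveʳ _ β (trans (sym (⊖-∷ʳ X Y′ y)) eq)
  y≤ : y ≤ length (Y′ ∷ʳ y)
  y≤ = proj₂ (IsPerm-∈ pʸ (Mem.∈-++⁺ʳ Y′ (here refl)))
  |Y|< : length (Y′ ∷ʳ y) < suc (length β)
  |Y|< = subst (length (Y′ ∷ʳ y) <_) (trans (sym (length-⊖ X (Y′ ∷ʳ y))) (trans (cong length eq) (length-⊕1 β)))
               (ℕ.m<n+m _ 0<|X|)

wrap-∷≢centre : ∀ {m m′ α} g → Centre m → Avoider α → All Avoider g → Centre m′ → wrap m (α ∷ g) ≢ m′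
wrap-∷≢centre {m} {α = α} g cm aα ag (inj₁ refl) eq =
  ℕ.1+n≢0 (trans (sym (ℕ.+-suc _ (length α))) (trans (sym (length-⊕1⊖ α _)) (cong length eq)))
wrap-∷≢centre {m} {α = α} g cm aα ag (inj₂ (β , _ , refl)) =
  ⊖≢⊕1 (α ⊕1) β (isPerm aY) (subst (0 <_) (sym (length-⊕1 α)) (s≤s z≤n)) Y≢[]
  where
  X = α ⊕1
  aY = ⊖-avoider (avoider (wrap-involutive g cm ag)) (avoider⁻¹ (avoiderInverse (⊕1-avoider aα)))
  Y≢[] : wrap m g ⊖ X ⁻¹ ≢ []
  Y≢[] Y≡[] = ℕ.1+n≢0 (trans (sym (trans (length-⁻¹ X) (length-⊕1 α)))
                              (cong length (List.++-conicalʳ (map _ (wrap m g)) (X ⁻¹) Y≡[])))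

wrap-injective : ∀ {m m′} g g′ → Centre m → Centre m′ → All Avoider g → All Avoider g′ →
                 wrap m g ≡ wrap m′ g′ → m ≡ m′ × g ≡ g′
wrap-injective []      []        _  _   _          _            eq = eq , refl
wrap-injective (α ∷ g) []        cm cm′ (aα ∷ ag)  _            eq = ⊥-elim (wrap-∷≢centre g cm aα ag cm′ eq)
wrap-injective []      (α′ ∷ g′) cm cm′ _          (aα′ ∷ ag′)  eq = ⊥-elim (wrap-∷≢centre g′ cm′ aα′ ag′ cm (sym eq))
wrap-injective (α ∷ g) (α′ ∷ g′) cm cm′ (aα ∷ ag)  (aα′ ∷ ag′)  eq
  with refl , Y≡ ← ⊕1⊖-injective (isPerm aα) (isPerm aα′) eq =
  let m≡ , g≡ = wrap-injective g g′ cm cm′ ag ag′ (⊖-cancelʳ ((α ⊕1) ⁻¹) Y≡) in m≡ , cong (α ∷_) g≡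

wrap-complete : ∀ {π} → InvolutiveAvoider π → ∃₂ λ m g → Centre m × All Avoider g × π ≡ wrap m g
wrap-complete = go (ℕ.<-wellFounded _)
  where
  go : ∀ {π} → Acc _<_ (length π) → InvolutiveAvoider π → ∃₂ λ m g → Centre m × All Avoider g × π ≡ wrap m g
  go {[]}     _        _                           = [] , [] , inj₁ refl , [] , refl
  go {x ∷ xs} (acc rs) (mkInvolutiveAvoider a inv) with decompose (isPerm a) (avoids a)
  ... | decomposition {α} {[]} aα _ π≡ =
    α ⊕1 , [] , inj₂ (α , mkInvolutiveAvoider aα α-involutive , refl) , [] , trans π≡ (⊖-identityʳ (α ⊕1))
    where
    α-involutive : α ⁻¹ ≡ α
    α-involutive = List.∷ʳ-injectiveˡ (α ⁻¹) α (begin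
      α ⁻¹ ⊕1       ≡⟨ ⁻¹-⊕1 (isPerm aα) ⟨
      (α ⊕1) ⁻¹     ≡⟨ cong _⁻¹ (trans (sym (⊖-identityʳ (α ⊕1))) (sym π≡)) ⟩
      (x ∷ xs) ⁻¹   ≡⟨ inv ⟩
      x ∷ xs        ≡⟨ trans π≡ (⊖-identityʳ (α ⊕1)) ⟩
      α ⊕1          ≡⟨ cong (λ n → α ∷ʳ suc n) (length-⁻¹ α) ⟨
      α ∷ʳ suc (length (α ⁻¹)) ∎)
      where open ≡-Reasoning
  ... | decomposition {α} {β@(_ ∷ _)} aα aβ π≡
    with γ , iγ , β≡ ← involution-tail aα aβ (λ ()) (subst (λ π → π ⁻¹ ≡ π) π≡ inv)
    with m , g , cm , ag , γ≡ ← go (rs (ℕ.≤-<-trans (subst (λ β → length γ ≤ length β) (sym β≡) (length-⊖ˡ γ _))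
                                                    (proj₂ (decomposition-shorter α β π≡)))) iγ =
    m , α ∷ g , cm , aα ∷ ag , trans π≡ (cong (α ⊕1 ⊖_) (trans β≡ (cong (_⊖ (α ⊕1) ⁻¹) γ≡)))

-- The monomial of α in x₁² C_S(x₁²x₂², x₂²x₃², …).
pairWeight : List ℕ → Mon
pairWeight α = (2 ∷ []) ⊗ σ₂ (mon α)

chainWeight : List (List ℕ) → Mon
chainWeight []      = []
chainWeight (α ∷ g) = pairWeight α ⊗ chainWeight g

pairWeight-≈ : ∀ α → pairWeight α ≈ₘ ((1 ∷ []) ⊗ σ₁ (mon α)) ⊗ ((1 ∷ []) ⊗ σ₁ (mon α))
pairWeight-≈ α = ≈ₘ-trans (⊗-cong (≈ₘ-refl {(1 ∷ []) ⊗ (1 ∷ [])}) (σ₂-≈ₘ (mon α)))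
  (⊗-Solver.solve 2 (λ x s → (x ∙ x) ∙ (s ∙ s) ⊜ (x ∙ s) ∙ (x ∙ s)) ≈ₘ-refl (1 ∷ []) (σ₁ (mon α)))
  where open ⊗-Solver using (_⊜_) renaming (_⊕_ to _∙_)

mon-wrap : ∀ {m} g → Centre m → All Avoider g → mon (wrap m g) ≈ₘ mon m ⊗ chainWeight g
mon-wrap {m} []      cm []        = ≈ₘ-sym (⊗-identityʳ (mon m))
mon-wrap {m} (α ∷ g) cm (aα ∷ ag) = begin
  mon (X ⊖ (W ⊖ X ⁻¹))
    ≈⟨ mon-⊖′ (isPerm aX) (⊖-isPerm (isPerm (avoider iW)) (isPerm aX⁻¹)) ⟩
  mon X ⊗ mon (W ⊖ X ⁻¹)
    ≈⟨ ⊗-cong (≈ₘ-refl {mon X}) (mon-⊖′ (isPerm (avoider iW)) (isPerm aX⁻¹)) ⟩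
  mon X ⊗ (mon W ⊗ mon (X ⁻¹))
    ≈⟨ ⊗-cong (mon-⊕1′ (isPerm aα)) (⊗-cong (mon-wrap g cm ag) (≈ₘ-trans (mon-⁻¹ invX) (mon-⊕1′ (isPerm aα)))) ⟩
  u ⊗ ((mon m ⊗ chainWeight g) ⊗ u)
    ≈⟨ ⊗-Solver.solve 3 (λ u m c → u ∙ ((m ∙ c) ∙ u) ⊜ m ∙ ((u ∙ u) ∙ c)) ≈ₘ-refl u (mon m) (chainWeight g) ⟩
  mon m ⊗ ((u ⊗ u) ⊗ chainWeight g)
    ≈⟨ ⊗-cong (≈ₘ-refl {mon m}) (⊗-cong (pairWeight-≈ α) (≈ₘ-refl {chainWeight g})) ⟨
  mon m ⊗ chainWeight (α ∷ g) ∎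
  where
  open ≈ₘ-Reasoning
  open ⊗-Solver using (_⊜_) renaming (_⊕_ to _∙_)
  X = α ⊕1
  W = wrap m g
  u = (1 ∷ []) ⊗ σ₁ (mon α)
  aX = ⊕1-avoider aα
  invX = avoiderInverse aX
  aX⁻¹ = avoider⁻¹ invX
  iW = wrap-involutive g cm ag

-- Graded enumerations and the series they realise

-- The definition of _⊛_, with arbitrary objects in place of monomials.
conv : {X Y Z : Set} → (X → Y → Z) → (ℕ → List X) → (ℕ → List Y) → ℕ → List Z
conv _∙_ F G d = concatMap (λ i → concatMap (λ x → map (x ∙_) (G (d ∸ i))) (F i)) (upTo (suc d))

module _ {X Y Z : Set} (_∙_ : X → Y → Z) (F : ℕ → List X) (G : ℕ → List Y) where

  ∈-conv⁻ : ∀ {d z} → z ∈ conv _∙_ F G d →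
            ∃ λ i → ∃₂ λ x y → i ≤ d × x ∈ F i × y ∈ G (d ∸ i) × z ≡ x ∙ y
  ∈-conv⁻ z∈
    with i , i∈ , z∈ᵢ ← ∈-concatMap⁻ _ z∈
    with x , x∈ , z∈ₓ ← ∈-concatMap⁻ _ z∈ᵢ
    with y , y∈ , z≡ ← Mem.∈-map⁻ _ z∈ₓ = i , x , y , ℕ.≤-pred (Mem.∈-upTo⁻ i∈) , x∈ , y∈ , z≡

  ∈-conv⁺ : ∀ {d i x y} → i ≤ d → x ∈ F i → y ∈ G (d ∸ i) → x ∙ y ∈ conv _∙_ F G d
  ∈-conv⁺ i≤d x∈ y∈ = ∈-concatMap⁺ _ (Mem.∈-upTo⁺ (s≤s i≤d)) (∈-concatMap⁺ _ x∈ (Mem.∈-map⁺ _ y∈))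

  conv-unique : ∀ d (size : X → ℕ) → (∀ {i x} → x ∈ F i → size x ≡ i) →
    (∀ i → Unique (F i)) → (∀ j → Unique (G j)) →
    (∀ {i i′ x x′ y y′} → x ∈ F i → x′ ∈ F i′ → y ∈ G (d ∸ i) → y′ ∈ G (d ∸ i′) →
       x ∙ y ≡ x′ ∙ y′ → x ≡ x′ × y ≡ y′) →
    Unique (conv _∙_ F G d)
  conv-unique d size sizeF uF uG inj =
    unique-concatMap⁺ _ (Unique.upTo⁺ (suc d)) (λ _ → uRow)
      (λ {i} {i′} _ _ z∈ z∈′ →
        let x , x∈ , z∈ₓ = ∈-concatMap⁻ _ z∈ ; y , y∈ , z≡ = Mem.∈-map⁻ _ z∈ₓ
            x′ , x∈′ , z∈ₓ′ = ∈-concatMap⁻ _ z∈′ ; y′ , y∈′ , z≡′ = Mem.∈-map⁻ _ z∈ₓ′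
        in trans (sym (sizeF x∈)) (trans (cong size (proj₁ (inj x∈ x∈′ y∈ y∈′ (trans (sym z≡) z≡′)))) (sizeF x∈′)))
    where
    uRow : ∀ {i} → Unique (concatMap (λ x → map (x ∙_) (G (d ∸ i))) (F i))
    uRow {i} = unique-concatMap⁺ _ (uF i)
      (λ x∈ → unique-map⁺ _ (λ y∈ y∈′ → proj₂ ∘ inj x∈ x∈ y∈ y∈′) (uG (d ∸ i)))
      (λ x∈ x∈′ z∈ z∈′ →
        let y , y∈ , z≡ = Mem.∈-map⁻ _ z∈ ; y′ , y∈′ , z≡′ = Mem.∈-map⁻ _ z∈′
        in proj₁ (inj x∈ x∈′ y∈ y∈′ (trans (sym z≡) z≡′)))

record Enumerates {X : Set} (F : ℕ → List X) (P : X → Set) (size : X → ℕ) : Set where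
  field
    sound    : ∀ {d x} → x ∈ F d → P x × size x ≡ d
    complete : ∀ {x} → P x → x ∈ F (size x)
    unique   : ∀ d → Unique (F d)
open Enumerates

enumerates-↭ : ∀ {X : Set} {F G : ℕ → List X} {P size} → Enumerates F P size → Enumerates G P size →
               ∀ d → F d ↭ G d
enumerates-↭ {P = P} {size} eF eG d = unique⇒↭ (unique eF d) (unique eG d) (transfer eF eG) (transfer eG eF)
  where
  transfer : ∀ {F G} → Enumerates F P size → Enumerates G P size → F d ⊆ G d
  transfer eF eG x∈ with px , refl ← sound eF x∈ = complete eG px

enumerates-⇔ : ∀ {X : Set} {F : ℕ → List X} {P Q : X → Set} {size} → Enumerates F P size →
               (∀ {x} → P x → Q x) → (∀ {x} → Q x → P x) → Enumerates F Q size
enumerates-⇔ e P⇒Q Q⇒P = record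
  { sound    = λ x∈ → let px , size≡ = sound e x∈ in P⇒Q px , size≡
  ; complete = complete e ∘ Q⇒P
  ; unique   = unique e
  }

enumerates-++ : ∀ {X : Set} {F G : ℕ → List X} {P Q : X → Set} {size} →
                Enumerates F P size → Enumerates G Q size → (∀ {x} → P x → Q x → ⊥) →
                Enumerates (λ d → F d ++ G d) (λ x → P x ⊎ Q x) size
enumerates-++ {F = F} eF eG disjoint = record
  { sound    = λ {d} x∈ → case Mem.∈-++⁻ (F d) x∈ of λ where
                 (inj₁ x∈F) → Prod.map₁ inj₁ (sound eF x∈F)
                 (inj₂ x∈G) → Prod.map₁ inj₂ (sound eG x∈G)
  ; complete = λ where
                 (inj₁ px) → Mem.∈-++⁺ˡ (complete eF px)
                 (inj₂ qx) → Mem.∈-++⁺ʳ (F _) (complete eG qx)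
  ; unique   = λ d → Unique.++⁺ (unique eF d) (unique eG d)
                       (λ (x∈F , x∈G) → disjoint (proj₁ (sound eF x∈F)) (proj₁ (sound eG x∈G)))
  }

enumerates-conv : ∀ {X Y Z : Set} {_∙_ : X → Y → Z} {F G P Q s t} (size : Z → ℕ) →
  Enumerates F P s → Enumerates G Q t →
  (∀ {x y} → P x → Q y → size (x ∙ y) ≡ s x + t y) →
  (∀ {x x′ y y′} → P x → P x′ → Q y → Q y′ → x ∙ y ≡ x′ ∙ y′ → x ≡ x′ × y ≡ y′) →
  Enumerates (conv _∙_ F G) (λ z → ∃₂ λ x y → P x × Q y × z ≡ x ∙ y) size
enumerates-conv {_∙_ = _∙_} {F} {G} {s = s} {t} size eF eG size-∙ inj = record
  { sound    = λ z∈ →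
      let i , x , y , i≤d , x∈ , y∈ , z≡ = ∈-conv⁻ _∙_ F G z∈
          px , sx≡ = sound eF x∈ ; qy , ty≡ = sound eG y∈
      in (x , y , px , qy , z≡) ,
         trans (cong size z≡) (trans (size-∙ px qy) (trans (cong₂ _+_ sx≡ ty≡) (ℕ.m+[n∸m]≡n i≤d)))
  ; complete = λ { (x , y , px , qy , refl) →
      subst (λ d → x ∙ y ∈ conv _∙_ F G d) (sym (size-∙ px qy))
        (∈-conv⁺ _∙_ F G (ℕ.m≤m+n (s x) (t y)) (complete eF px)
                 (subst (λ d → y ∈ G d) (sym (ℕ.m+n∸m≡n (s x) (t y))) (complete eG qy))) }
  ; unique   = λ d → conv-unique _∙_ F G d s (proj₂ ∘ sound eF) (unique eF) (unique eG)
                       (λ x∈ x∈′ y∈ y∈′ → inj (proj₁ (sound eF x∈)) (proj₁ (sound eF x∈′))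
                                              (proj₁ (sound eG y∈)) (proj₁ (sound eG y∈′)))
  }

Realises : {X : Set} → (X → Mon) → (ℕ → List X) → Series → Set
Realises w F S = ∀ d → map (trim ∘ w) (F d) ≡ map trim (S d)

trimmedProduct : List Mon → List Mon → List Mon
trimmedProduct A B = concatMap (λ a → map (λ b → trim (a ⊗ b)) B) A

trim-product : ∀ {X Y Z : Set} (_∙_ : X → Y → Z) (w : Z → Mon) (f : X → Mon) (g : Y → Mon) xs ys →
  (∀ {x y} → x ∈ xs → y ∈ ys → w (x ∙ y) ≈ₘ f x ⊗ g y) →
  map (trim ∘ w) (concatMap (λ x → map (x ∙_) ys) xs) ≡ trimmedProduct (map (trim ∘ f) xs) (map (trim ∘ g) ys)
trim-product _∙_ w f g xs ys w≈ = begin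
  map (trim ∘ w) (concatMap (λ x → map (x ∙_) ys) xs)
    ≡⟨ List.map-concatMap (trim ∘ w) _ xs ⟩
  concatMap (λ x → map (trim ∘ w) (map (x ∙_) ys)) xs
    ≡⟨ concatMap-cong-local xs row ⟩
  concatMap (λ x → map (λ b → trim (trim (f x) ⊗ b)) (map (trim ∘ g) ys)) xs
    ≡⟨ List.concatMap-map _ (trim ∘ f) xs ⟨
  trimmedProduct (map (trim ∘ f) xs) (map (trim ∘ g) ys) ∎
  where
  open ≡-Reasoning
  row : ∀ {x} → x ∈ xs → map (trim ∘ w) (map (x ∙_) ys) ≡ map (λ b → trim (trim (f x) ⊗ b)) (map (trim ∘ g) ys)
  row {x} x∈ = begin
    map (trim ∘ w) (map (x ∙_) ys)                        ≡⟨ List.map-∘ ys ⟨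
    map (λ y → trim (w (x ∙ y))) ys                       ≡⟨ List.map-cong-local (All.tabulate (trim≡ ∘ w≈ x∈)) ⟩
    map (λ y → trim (trim (f x) ⊗ trim (g y))) ys          ≡⟨ List.map-∘ ys ⟩
    map (λ b → trim (trim (f x) ⊗ b)) (map (trim ∘ g) ys) ∎
    where
    trim≡ : ∀ {y} → w (x ∙ y) ≈ₘ f x ⊗ g y → trim (w (x ∙ y)) ≡ trim (trim (f x) ⊗ trim (g y))
    trim≡ {y} w≈ = ≈ₘ⇒trim≡ (≈ₘ-trans w≈ (⊗-cong (≈ₘ-sym (trim-≈ₘ (f x))) (≈ₘ-sym (trim-≈ₘ (g y)))))

realises-conv : ∀ {X Y Z : Set} {_∙_ : X → Y → Z} {F G} {wˣ : X → Mon} {wʸ : Y → Mon} {w : Z → Mon} {S T} →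
  Realises wˣ F S → Realises wʸ G T →
  (∀ {i j x y} → x ∈ F i → y ∈ G j → w (x ∙ y) ≈ₘ wˣ x ⊗ wʸ y) →
  Realises w (conv _∙_ F G) (S ⊛ T)
realises-conv {_∙_ = _∙_} {F} {G} {wˣ} {wʸ} {w} {S} {T} rF rG w≈ d = begin
  map (trim ∘ w) (conv _∙_ F G d)
    ≡⟨ List.map-concatMap (trim ∘ w) _ (upTo (suc d)) ⟩
  concatMap (λ i → map (trim ∘ w) (concatMap (λ x → map (x ∙_) (G (d ∸ i))) (F i))) (upTo (suc d))
    ≡⟨ concatMap-cong-local (upTo (suc d)) (λ {i} _ → degree i) ⟩
  concatMap (λ i → map trim (concatMap (λ a → map (a ⊗_) (T (d ∸ i))) (S i))) (upTo (suc d))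
    ≡⟨ List.map-concatMap trim _ (upTo (suc d)) ⟨
  map trim ((S ⊛ T) d) ∎
  where
  open ≡-Reasoning
  degree : ∀ i → map (trim ∘ w) (concatMap (λ x → map (x ∙_) (G (d ∸ i))) (F i))
               ≡ map trim (concatMap (λ a → map (a ⊗_) (T (d ∸ i))) (S i))
  degree i = begin
    map (trim ∘ w) (concatMap (λ x → map (x ∙_) (G (d ∸ i))) (F i))
      ≡⟨ trim-product _∙_ w wˣ wʸ (F i) (G (d ∸ i)) w≈ ⟩
    trimmedProduct (map (trim ∘ wˣ) (F i)) (map (trim ∘ wʸ) (G (d ∸ i)))
      ≡⟨ cong₂ trimmedProduct (rF i) (rG (d ∸ i)) ⟩
    trimmedProduct (map trim (S i)) (map trim (T (d ∸ i)))
      ≡⟨ trim-product _⊗_ (λ a → a) (λ a → a) (λ b → b) (S i) (T (d ∸ i)) (λ _ _ → ≈ₘ-refl) ⟨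
    map trim (concatMap (λ a → map (a ⊗_) (T (d ∸ i))) (S i)) ∎

realises-++ : ∀ {X : Set} {w : X → Mon} {F G S T} → Realises w F S → Realises w G T →
              Realises w (λ d → F d ++ G d) (S ⊕ T)
realises-++ {w = w} {F} {G} {S} {T} rF rG d = begin
  map (trim ∘ w) (F d ++ G d)                 ≡⟨ List.map-++ (trim ∘ w) (F d) (G d) ⟩
  map (trim ∘ w) (F d) ++ map (trim ∘ w) (G d) ≡⟨ cong₂ _++_ (rF d) (rG d) ⟩
  map trim (S d) ++ map trim (T d)            ≡⟨ List.map-++ trim (S d) (T d) ⟨
  map trim ((S ⊕ T) d)                        ∎
  where open ≡-Reasoning

singleton : ℕ → ℕ → List ⊤
singleton k d = if k ≡ᵇ d then tt ∷ [] else []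

onlyEmpty : {X : Set} → ℕ → List (List X)
onlyEmpty d = if 0 ≡ᵇ d then [] ∷ [] else []

enumerates-singleton : ∀ k → Enumerates (singleton k) (λ _ → ⊤) (λ _ → k)
enumerates-singleton k = record
  { sound    = λ x∈ → tt , ≡ᵇ-true⇒≡ (proj₁ (∈-if⁻ x∈))
  ; complete = λ _ → subst (λ b → tt ∈ (if b then tt ∷ [] else [])) (sym (≡ᵇ-refl k)) (here refl)
  ; unique   = λ d → if-unique (k ≡ᵇ d) ([] ∷ [])
  }

enumerates-onlyEmpty : ∀ {X : Set} {size : List X → ℕ} → size [] ≡ 0 → Enumerates onlyEmpty (_≡ []) size
enumerates-onlyEmpty size[]≡0 = record
  { sound    = λ {d} x∈ → let 0≡d , x∈′ = ∈-if⁻ {b = 0 ≡ᵇ d} x∈ in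
                          case x∈′ of λ { (here refl) → refl , trans size[]≡0 (≡ᵇ-true⇒≡ 0≡d) }
  ; complete = λ { refl → subst (λ d → [] ∈ onlyEmpty d) (sym size[]≡0) (here refl) }
  ; unique   = λ d → if-unique (0 ≡ᵇ d) ([] ∷ [])
  }

realises-singleton : ∀ k → Realises (λ _ → k ∷ []) (singleton k) (x₁^ k)
realises-singleton k d with k ≡ᵇ d
... | true  = refl
... | false = refl

realises-onlyEmpty : ∀ {X : Set} (w : List X → Mon) → trim (w []) ≡ [] → Realises w onlyEmpty one
realises-onlyEmpty w w[]≡ zero    = cong (_∷ []) w[]≡
realises-onlyEmpty w w[]≡ (suc d) = refl

enumerates-S132 : Enumerates S132 Avoider length
enumerates-S132 = record
  { sound    = λ π∈ → let π∈perms , avoid = Mem.∈-filter⁻ (T? ∘ (not ∘ contains132)) π∈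
                          π↭ = ∈-perms⁻ π∈perms
                      in mkAvoider (↭oneTo⇒IsPerm π↭) (Equivalence.to Bool.T-not-≡ avoid) , ↭oneTo-length π↭
  ; complete = λ (mkAvoider p avoid) →
      Mem.∈-filter⁺ (T? ∘ (not ∘ contains132)) (∈-perms⁺ p) (Equivalence.from Bool.T-not-≡ avoid)
  ; unique   = λ n → Unique.filter⁺ (T? ∘ (not ∘ contains132)) (perms-unique n)
  }

enumerates-I132 : Enumerates I132 InvolutiveAvoider length
enumerates-I132 = record
  { sound    = λ π∈ → let π∈S , invol = Mem.∈-filter⁻ (T? ∘ isInvolution) π∈
                          a , len = sound enumerates-S132 π∈S
                      in mkInvolutiveAvoider a (Equivalence.to (isInvolution⇔ (isPerm a)) (Equivalence.to Bool.T-≡ invol))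
                         , len
  ; complete = λ (mkInvolutiveAvoider a invol) →
      Mem.∈-filter⁺ (T? ∘ isInvolution) (complete enumerates-S132 a)
        (Equivalence.from Bool.T-≡ (Equivalence.from (isInvolution⇔ (isPerm a)) invol))
  ; unique   = λ n → Unique.filter⁺ (T? ∘ isInvolution) (unique enumerates-S132 n)
  }

doubled : {X : Set} → (ℕ → List X) → ℕ → List X
doubled F d = concatMap (λ j → if 2 * j ≡ᵇ d then F j else []) (upTo (suc d))

enumerates-doubled : ∀ {X : Set} {F : ℕ → List X} {P size} → Enumerates F P size →
                     Enumerates (doubled F) P (λ x → 2 * size x)
enumerates-doubled {F = F} {size = size} e = record
  { sound    = λ {d} x∈ → let j , _ , x∈′ = ∈-concatMap⁻ (λ j → if 2 * j ≡ᵇ d then F j else []) {upTo (suc d)} x∈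
                              2j≡d , x∈F = ∈-if⁻ {b = 2 * j ≡ᵇ d} x∈′ ; px , sx≡ = sound e {j} x∈F
                      in px , trans (cong (2 *_) sx≡) (≡ᵇ-true⇒≡ 2j≡d)
  ; complete = λ {x} px → ∈-concatMap⁺ _ (Mem.∈-upTo⁺ (s≤s (ℕ.m≤n*m (size x) 2)))
                 (subst (λ b → x ∈ (if b then F (size x) else [])) (sym (≡ᵇ-refl (2 * size x))) (complete e px))
  ; unique   = λ d → unique-concatMap⁺ _ (Unique.upTo⁺ (suc d)) (λ {j} _ → if-unique (2 * j ≡ᵇ d) (unique e j))
                       (λ _ _ x∈ x∈′ → trans (sym (proj₂ (sound e (proj₂ (∈-if⁻ x∈)))))
                                             (proj₂ (sound e (proj₂ (∈-if⁻ x∈′)))))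
  }

realises-doubled-S132 : Realises (σ₂ ∘ mon) (doubled S132) (substS₂ C-S)
realises-doubled-S132 d = trans (List.map-∘ (doubled S132 d)) (cong (map trim) (begin
  map (σ₂ ∘ mon) (doubled S132 d)
    ≡⟨ List.map-concatMap (σ₂ ∘ mon) _ (upTo (suc d)) ⟩
  concatMap (λ j → map (σ₂ ∘ mon) (if 2 * j ≡ᵇ d then S132 j else [])) (upTo (suc d))
    ≡⟨ concatMap-cong-local (upTo (suc d)) (λ {j} _ → row (2 * j ≡ᵇ d) j) ⟩
  substS₂ C-S d ∎))
  where
  open ≡-Reasoning
  row : ∀ b j → map (σ₂ ∘ mon) (if b then S132 j else []) ≡ (if b then map σ₂ (C-S j) else [])
  row true  j = List.map-∘ (S132 j)
  row false j = refl

pairs : ℕ → List (List ℕ)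
pairs = conv (λ _ α → α) (singleton 2) (doubled S132)

enumerates-pairs : Enumerates pairs Avoider (λ α → 2 + 2 * length α)
enumerates-pairs =
  enumerates-⇔ (enumerates-conv (λ α → 2 + 2 * length α) (enumerates-singleton 2) (enumerates-doubled enumerates-S132)
                                (λ _ _ → refl) (λ _ _ _ _ α≡ → refl , α≡))
               (λ { (_ , _ , _ , a , refl) → a }) (λ a → tt , _ , tt , a , refl)

realises-pairs : Realises pairWeight pairs (x₁^ 2 ⊛ substS₂ C-S)
realises-pairs = realises-conv {wˣ = λ _ → 2 ∷ []} {wʸ = σ₂ ∘ mon} {w = pairWeight}
                               (realises-singleton 2) realises-doubled-S132 (λ _ _ → ≈ₘ-refl)

chainsOf : ℕ → ℕ → List (List (List ℕ))
chainsOf zero    = onlyEmpty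
chainsOf (suc j) = conv _∷_ pairs (chainsOf j)

enumerates-chainsOf : ∀ j → Enumerates (chainsOf j) (λ g → All Avoider g × length g ≡ j) chainSize
enumerates-chainsOf zero    =
  enumerates-⇔ (enumerates-onlyEmpty refl) (λ { refl → [] , refl }) (λ { ([] , refl) → refl })
enumerates-chainsOf (suc j) =
  enumerates-⇔ (enumerates-conv chainSize enumerates-pairs (enumerates-chainsOf j)
                                (λ _ _ → refl) (λ _ _ _ _ → List.∷-injective))
               (λ { (_ , _ , a , (ag , refl) , refl) → a ∷ ag , refl })
               (λ { (a ∷ ag , refl) → _ , _ , a , (ag , refl) , refl })

realises-chainsOf : ∀ j → Realises chainWeight (chainsOf j) (pow (x₁^ 2 ⊛ substS₂ C-S) j)
realises-chainsOf zero    = realises-onlyEmpty chainWeight refl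
realises-chainsOf (suc j) = realises-conv {wˣ = pairWeight} {wʸ = chainWeight} {w = chainWeight}
                                          realises-pairs (realises-chainsOf j) (λ _ _ → ≈ₘ-refl)

chains : ℕ → List (List (List ℕ))
chains d = concatMap (λ j → chainsOf j d) (upTo (suc d))

length≤chainSize : ∀ g → length g ≤ chainSize g
length≤chainSize []      = z≤n
length≤chainSize (α ∷ g) = s≤s (ℕ.≤-trans (length≤chainSize g) (ℕ.m≤n+m (chainSize g) (suc (2 * length α))))

enumerates-chains : Enumerates chains (All Avoider) chainSize
enumerates-chains = record
  { sound    = λ {d} g∈ → let j , _ , g∈ⱼ = ∈-concatMap⁻ (λ j → chainsOf j d) {upTo (suc d)} g∈
                              (ag , _) , size≡ = sound (enumerates-chainsOf j) g∈ⱼ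
                      in ag , size≡
  ; complete = λ {g} ag → ∈-concatMap⁺ _ (Mem.∈-upTo⁺ (s≤s (length≤chainSize g)))
                                        (complete (enumerates-chainsOf (length g)) (ag , refl))
  ; unique   = λ d → unique-concatMap⁺ _ (Unique.upTo⁺ (suc d)) (λ {j} _ → unique (enumerates-chainsOf j) d)
                       (λ {j} {j′} _ _ g∈ g∈′ → trans (sym (proj₂ (proj₁ (sound (enumerates-chainsOf j) {d} g∈))))
                                                      (proj₂ (proj₁ (sound (enumerates-chainsOf j′) {d} g∈′))))
  }

realises-chains : Realises chainWeight chains (geom (x₁^ 2 ⊛ substS₂ C-S))
realises-chains d = begin
  map (trim ∘ chainWeight) (concatMap (λ j → chainsOf j d) (upTo (suc d)))
    ≡⟨ List.map-concatMap _ _ (upTo (suc d)) ⟩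
  concatMap (λ j → map (trim ∘ chainWeight) (chainsOf j d)) (upTo (suc d))
    ≡⟨ concatMap-cong-local (upTo (suc d)) (λ {j} _ → realises-chainsOf j d) ⟩
  concatMap (λ j → map trim (pow A j d)) (upTo (suc d))
    ≡⟨ List.map-concatMap trim _ (upTo (suc d)) ⟨
  map trim (geom A d) ∎
  where
  open ≡-Reasoning
  A = x₁^ 2 ⊛ substS₂ C-S

centres : ℕ → List (List ℕ)
centres d = onlyEmpty d ++ conv (λ _ α → α ⊕1) (singleton 1) I132 d

enumerates-centres : Enumerates centres Centre length
enumerates-centres =
  enumerates-⇔ (enumerates-++ (enumerates-onlyEmpty refl)
                  (enumerates-conv length (enumerates-singleton 1) enumerates-I132 (λ {_} {α} _ _ → length-⊕1 α)
                                   (λ _ _ _ _ eq → refl , List.∷ʳ-injectiveˡ _ _ eq))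
                  (λ { refl (_ , α , _ , _ , []≡) → ℕ.1+n≢0 (sym (trans (cong length []≡) (length-⊕1 α))) }))
    (λ { (inj₁ refl) → inj₁ refl ; (inj₂ (_ , α , _ , iα , refl)) → inj₂ (α , iα , refl) })
    (λ { (inj₁ refl) → inj₁ refl ; (inj₂ (α , iα , refl)) → inj₂ (tt , α , tt , iα , refl) })

realises-substS₁-I132 : Realises (σ₁ ∘ mon) I132 (substS₁ C-I)
realises-substS₁-I132 d = trans (List.map-∘ {g = trim} {f = σ₁ ∘ mon} (I132 d))
                                (cong (map trim) (List.map-∘ {g = σ₁} {f = mon} (I132 d)))

realises-centres : Realises mon centres (one ⊕ (x₁^ 1 ⊛ substS₁ C-I))
realises-centres = realises-++ {w = mon} (realises-onlyEmpty mon refl)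
  (realises-conv {wˣ = λ _ → 1 ∷ []} {wʸ = σ₁ ∘ mon} {w = mon} (realises-singleton 1) realises-substS₁-I132
                 (λ {_} {j} _ α∈ → mon-⊕1′ (isPerm (avoider (proj₁ (sound enumerates-I132 {j} α∈))))))

shapes : ℕ → List (List ℕ)
shapes = conv wrap centres chains

enumerates-shapes : Enumerates shapes InvolutiveAvoider length
enumerates-shapes =
  enumerates-⇔ (enumerates-conv length enumerates-centres enumerates-chains (λ {_} {g} _ _ → length-wrap g)
                                (λ {_} {_} {g} {g′} cm cm′ ag ag′ → wrap-injective g g′ cm cm′ ag ag′))
    (λ { (_ , g , cm , ag , refl) → wrap-involutive g cm ag })
    wrap-complete

realises-shapes : Realises mon shapes ((one ⊕ (x₁^ 1 ⊛ substS₁ C-I)) ⊛ geom (x₁^ 2 ⊛ substS₂ C-S))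
realises-shapes = realises-conv {wˣ = mon} {wʸ = chainWeight} {w = mon} realises-centres realises-chains
  (λ {i} {j} m∈ g∈ → mon-wrap _ (proj₁ (sound enumerates-centres {i} m∈))
                                (proj₁ (sound enumerates-chains {j} g∈)))

theorem4p2 : C-I ≈ₛ ((one ⊕ (x₁^ 1 ⊛ substS₁ C-I)) ⊛ geom (x₁^ 2 ⊛ substS₂ C-S))
theorem4p2 d = begin
  map trim (C-I d)            ≡⟨ List.map-∘ (I132 d) ⟨
  map (trim ∘ mon) (I132 d)   ↭⟨ Perm.map⁺ (trim ∘ mon) (enumerates-↭ enumerates-I132 enumerates-shapes d) ⟩
  map (trim ∘ mon) (shapes d) ≡⟨ realises-shapes d ⟩
  map trim (((one ⊕ (x₁^ 1 ⊛ substS₁ C-I)) ⊛ geom (x₁^ 2 ⊛ substS₂ C-S)) d) ∎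
  where open PermutationReasoning
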